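{- Let $H$ be one of the graphs $K_1$, $\overline{K}_2$, $\overline{K}_3$, $K_4$, $\overline{K}_4$, $C_5$, $3K_2$, $K_{2,3}$, $K_{3,3}$. Then there exists at least one subcubic graph $G$ having a connected coalition partition $\pi$ with $CCG(G,\pi)\cong H$, and every subcubic graph $G$ having a connected coalition partition $\pi$ with $CCG(G,\pi)\cong H$ has order at most 10. Hence $H$ arises in this way from only finitely many subcubic graphs (up to isomorphism).
   Context: All graphs are finite and simple. A graph is subcubic if it is connected and its maximum vertex degree is at most 3. For a graph $G$ with vertex set $V$ and $S\subseteq V$, $G[S]$ denotes the induced subgraph. A set $D\subseteq V$ is dominating if every vertex of $V\setminus D$ has a neighbour in $D$; it is a connected dominating set if moreover $G[D]$ is connected. Two disjoint subsets $A,B\subseteq V$ form a connected coalition if neither $A$ nor $B$ is a connected dominating set but $A\cup B$ is a connected dominating set. A connected coalition partition of $G$ is a partition $\pi=\{V_1,\dots,V_k\}$ of $V$ such that each $V_i$ either is a connected dominating set consisting of a single vertex, or forms a connected coalition with some set of $\pi$. The coalition graph $CCG(G,\pi)$ has vertex set $\{V_1,\dots,V_k\}$, with $V_i$ and $V_j$ adjacent if and only if they form a connected coalition in $G$. $\overline{K}_n$ is the edgeless graph on $n$ vertices and $3K_2$ is the disjoint union of three copies of $K_2$. -}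

module Defs where

open import Data.Nat using (ℕ; zero; suc; _+_; _≤_; _<ᵇ_; _≡ᵇ_; _/_; _%_)
open import Data.Bool using (Bool; true; false; if_then_else_; not; _∧_; _∨_; _xor_)
open import Data.Fin using (Fin; toℕ)
open import Data.List using (List; map; allFin)
open import Data.Nat.ListAction using (sum)
open import Data.Product using (Σ; ∃; _×_; _,_)
open import Data.Sum using (_⊎_)
open import Relation.Nullary using (¬_)
open import Relation.Binary.PropositionalEquality using (_≡_; _≢_)
open import Function.Bundles using (_↔_; Inverse)

record Graph (n : ℕ) : Set where
  field
    adj    : Fin n → Fin n → Bool
    sym    : ∀ i j → adj i j ≡ adj j i
    irrefl : ∀ i → adj i i ≡ false
open Graph public

VSet : ℕ → Set
VSet n = Fin n → Bool

_∈_ : ∀ {n} → Fin n → VSet n → Set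
v ∈ S = S v ≡ true

_∪_ : ∀ {n} → VSet n → VSet n → VSet n
(A ∪ B) v = A v ∨ B v

degree : ∀ {n} → Graph n → Fin n → ℕ
degree {n} G i = sum (map (λ j → if adj G i j then 1 else 0) (allFin n))

-- Walks inside S : a walk from u to v all of whose vertices after u lie
-- in S (u itself is required to be in S where it is used).
data Reach {n} (G : Graph n) (S : VSet n) : Fin n → Fin n → Set where
  here : ∀ {u} → Reach G S u u
  step : ∀ {u w v} → adj G u w ≡ true → w ∈ S → Reach G S w v → Reach G S u v

InducedConnected : ∀ {n} → Graph n → VSet n → Set
InducedConnected G S = ∀ u v → u ∈ S → v ∈ S → Reach G S u v

full : ∀ {n} → VSet n
full _ = true

Connected : ∀ {n} → Graph n → Set
Connected G = InducedConnected G full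

Subcubic : ∀ {n} → Graph n → Set
Subcubic {n} G = Connected G × (∀ i → degree G i ≤ 3)

Dominating : ∀ {n} → Graph n → VSet n → Set
Dominating G D = ∀ v → ¬ (v ∈ D) → ∃ λ u → u ∈ D × adj G v u ≡ true

IsCDS : ∀ {n} → Graph n → VSet n → Set
IsCDS G D = Dominating G D × InducedConnected G D

Disjoint : ∀ {n} → VSet n → VSet n → Set
Disjoint A B = ∀ v → v ∈ A → v ∈ B → Data.Empty.⊥
  where import Data.Empty

ConnCoalition : ∀ {n} → Graph n → VSet n → VSet n → Set
ConnCoalition G A B =
  Disjoint A B × ¬ IsCDS G A × ¬ IsCDS G B × IsCDS G (A ∪ B)

record Partition (n k : ℕ) : Set where
  field
    part     : Fin n → Fin k
    nonempty : ∀ i → ∃ λ v → part v ≡ i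
open Partition public

cls : ∀ {n k} → Partition n k → Fin k → VSet n
cls π i v = ⌊ Data.Fin.Properties._≟_ (part π v) i ⌋
  where open import Relation.Nullary.Decidable using (⌊_⌋)
        import Data.Fin.Properties

Singleton : ∀ {n} → VSet n → Set
Singleton S = ∃ λ v → v ∈ S × (∀ w → w ∈ S → w ≡ v)

IsCCP : ∀ {n k} → Graph n → Partition n k → Set
IsCCP {k = k} G π =
  ∀ i → (IsCDS G (cls π i) × Singleton (cls π i))
        ⊎ (∃ λ (j : Fin k) → j ≢ i × ConnCoalition G (cls π i) (cls π j))

CCGAdj : ∀ {n k} → Graph n → Partition n k → Fin k → Fin k → Set
CCGAdj G π i j = ConnCoalition G (cls π i) (cls π j)

CCGIso : ∀ {n k m} → Graph n → Partition n k → (Fin m → Fin m → Bool) → Set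
CCGIso {k = k} {m = m} G π H =
  Σ (Fin k ↔ Fin m) λ σ →
    ∀ i j → (CCGAdj G π i j → H (Inverse.to σ i) (Inverse.to σ j) ≡ true)
          × (H (Inverse.to σ i) (Inverse.to σ j) ≡ true → CCGAdj G π i j)

data Target : Set where
  K1 coK2 coK3 K4 coK4 C5 threeK2 K23 K33 : Target

order : Target → ℕ
order K1      = 1
order coK2    = 2
order coK3    = 3
order K4      = 4
order coK4    = 4
order C5      = 5
order threeK2 = 6
order K23     = 5
order K33     = 6

private
  neq : ℕ → ℕ → Bool
  neq a b = not (a ≡ᵇ b)

adjOf : (t : Target) → Fin (order t) → Fin (order t) → Bool
adjOf K1      i j = false
adjOf coK2    i j = false
adjOf coK3    i j = false
adjOf K4      i j = neq (toℕ i) (toℕ j)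
adjOf coK4    i j = false
adjOf C5      i j = ((suc (toℕ i)) % 5 ≡ᵇ toℕ j) ∨ ((suc (toℕ j)) % 5 ≡ᵇ toℕ i)
adjOf threeK2 i j = ((toℕ i / 2) ≡ᵇ (toℕ j / 2)) ∧ neq (toℕ i) (toℕ j)
adjOf K23     i j = (toℕ i <ᵇ 2) xor (toℕ j <ᵇ 2)
adjOf K33     i j = (toℕ i <ᵇ 3) xor (toℕ j <ᵇ 3)

{-# OPTIONS --safe #-}
module Submission where

-- Every edge {i , j} of the coalition graph makes U = Vᵢ ∪ Vⱼ a connected dominating set. With
-- maximum degree 3, G[U] uses at least 2(|U| - 1) of the at most 3|U| arc ends at U and every
-- vertex outside U needs one of the others, so n ≤ 2|U| + 2. Summed over a perfect matching of
-- 3K₂ or K₃,₃ this gives n ≤ 6, and over the five edges of C₅ it gives 5n ≤ 4n + 10. If H has no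
-- edges, every class is a singleton connected dominating set, so n ≤ |H| ≤ 4.
-- For K₄, domination by the pairs of other classes leaves each vertex at most one neighbour in its
-- own class; adding the spanning-tree bounds of the three coalitions at Vᵢ gives n ≤ 2|Vᵢ| + 6, and
-- n ≥ 11 would force |V₀| = 3 with an odd number 3 of arc ends inside V₀.
-- For K₂,₃ with sides {V₀ , V₁} and {V₂ , V₃ , V₄}, two disjoint coalitions bound each B-class by 2.
-- A tightness argument shows that every vertex of V₀ ∪ V₁ has no neighbour in V₀ ∪ V₁ and exactly
-- one in V₂; as V₀ ∪ V₂ is connected, |V₀| + |V₁| ≤ |V₂| + 2 ≤ 4.

open import Defs hiding (sym)
open import Data.Nat using (ℕ; zero; suc; _+_; _*_; _≤_; z≤n; s≤s; _≡ᵇ_; _≤?_)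
open import Data.Nat.Properties hiding (_≟_)
open import Data.Nat.Divisibility using (_∣_; _∣?_; divides)
open import Data.Nat.ListAction using () renaming (sum to sumᴸ)
open import Data.Nat.Tactic.RingSolver using (solve-∀)
open import Data.Fin using (Fin; zero; suc; toℕ; punchIn)
open import Data.Fin.Patterns using (0F; 1F; 2F; 3F; 4F; 5F)
open import Data.Fin.Properties using (_≟_; any?; all?; injective⇒≤; toℕ-injective; punchInᵢ≢i; punchIn-injective)
open import Data.Bool using (Bool; true; false; not; _∨_; _∧_; T; if_then_else_)
open import Data.Bool.Properties using (∨-comm; ∨-zeroʳ) renaming (_≟_ to _≟ᵇ_)
open import Data.Bool.ListAction using (any)
open import Data.Unit using (tt)
open import Data.Empty using (⊥; ⊥-elim)
open import Data.Product using (Σ; ∃; _×_; _,_; proj₁; proj₂)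
open import Data.Sum using (_⊎_; inj₁; inj₂)
open import Data.List using (List; []; _∷_; allFin; tabulate) renaming (map to mapᴸ)
open import Data.List.Properties using (map-tabulate)
open import Data.Maybe using (Maybe; just; nothing; map; zipWith; _<∣>_; _>>=_; from-just)
open import Data.Vec using (lookup; []; _∷_)
open import Data.Vec.Functional using (foldr)
open import Function using (_∘_; id; case_of_)
open import Function.Bundles using (Inverse; _⇔_; mk⇔)
open import Function.Construct.Identity using (↔-id)
open import Relation.Nullary using (¬_; Dec; yes; no; ¬?; _×-dec_; _→-dec_)
open import Relation.Nullary.Decidable using (does; does-⇔; isYes≗does; dec⇒maybe; from-no)
open import Relation.Unary using (Decidable)
open import Relation.Binary.PropositionalEquality
open import Algebra.Properties.Semiring.Sum +-*-semiring
  using (sum; sum-cong-≗; ∑-distrib-+; ∑-comm; *-distribˡ-sum; sum-remove)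

𝟙 : Bool → ℕ
𝟙 true  = 1
𝟙 false = 0

sum-mono-≤ : ∀ {n} {f g : Fin n → ℕ} → (∀ i → f i ≤ g i) → sum f ≤ sum g
sum-mono-≤ {zero}  f≤g = z≤n
sum-mono-≤ {suc n} f≤g = +-mono-≤ (f≤g zero) (sum-mono-≤ (f≤g ∘ suc))

sum-const : ∀ n c → sum {n} (λ _ → c) ≡ n * c
sum-const zero    c = refl
sum-const (suc n) c = cong (c +_) (sum-const n c)

≤-sum : ∀ {n} (f : Fin n → ℕ) i → f i ≤ sum f
≤-sum f zero    = m≤m+n (f zero) _
≤-sum f (suc i) = ≤-trans (≤-sum (λ j → f (suc j)) i) (m≤n+m _ (f zero))

sum-point : ∀ {n} (w : Fin n) (f : Fin n → ℕ) → sum (λ u → 𝟙 (does (u ≟ w)) * f u) ≡ f w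
sum-point {suc n} zero f =
  trans (cong₂ _+_ (*-identityˡ (f zero)) (trans (sum-cong-≗ off) (trans (sum-const n 0) (*-zeroʳ n)))) (+-identityʳ (f zero))
  where
  off : ∀ u → 𝟙 (does (suc u ≟ zero)) * f (suc u) ≡ 0
  off u = refl
sum-point {suc n} (suc w) f = sum-point {n} w (λ u → f (suc u))

sum-squeeze : ∀ {n} {f g : Fin n → ℕ} → (∀ i → f i ≤ g i) → sum g ≤ sum f → ∀ i → f i ≡ g i
sum-squeeze {suc n} f≤g Σg≤Σf zero =
  ≤-antisym (f≤g zero)
    (+-cancelʳ-≤ _ _ _ (≤-trans (+-monoʳ-≤ _ (sum-mono-≤ (λ i → f≤g (suc i)))) Σg≤Σf))
sum-squeeze {suc n} {f} f≤g Σg≤Σf (suc i) =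
  sum-squeeze (λ j → f≤g (suc j))
    (+-cancelˡ-≤ (f zero) _ _ (≤-trans (+-monoˡ-≤ _ (f≤g zero)) Σg≤Σf)) i

sumᴸ-tabulate : ∀ {n} (f : Fin n → ℕ) → sumᴸ (tabulate f) ≡ sum f
sumᴸ-tabulate {zero}  f = refl
sumᴸ-tabulate {suc n} f = cong (f zero +_) (sumᴸ-tabulate (λ i → f (suc i)))

sum-symmetric-even : ∀ {n} (f : Fin n → Fin n → ℕ) → (∀ i j → f i j ≡ f j i) → (∀ i → f i i ≡ 0) →
                     2 ∣ sum (λ i → sum (λ j → f i j))
sum-symmetric-even {zero}  f sym-f diag-f = divides 0 refl
sum-symmetric-even {suc n} f sym-f diag-f
  with sum-symmetric-even (λ i j → f (suc i) (suc j)) (λ i j → sym-f (suc i) (suc j)) (λ i → diag-f (suc i))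
... | divides q inner = divides (r + q) (begin
    f zero zero + r + sum (λ i → f (suc i) zero + sum (λ j → f (suc i) (suc j)))
      ≡⟨ cong₂ _+_ (cong (_+ r) (diag-f zero)) (∑-distrib-+ (λ i → f (suc i) zero) _) ⟩
    r + (sum (λ i → f (suc i) zero) + sum (λ i → sum (λ j → f (suc i) (suc j))))
      ≡⟨ cong₂ (λ c s → r + (c + s)) (sum-cong-≗ (λ i → sym-f (suc i) zero)) inner ⟩
    r + (r + q * 2)
      ≡⟨ regroup r q ⟩
    (r + q) * 2 ∎)
  where
  open ≡-Reasoning
  r : ℕ
  r = sum (λ j → f zero (suc j))
  regroup : ∀ r q → r + (r + q * 2) ≡ (r + q) * 2
  regroup = solve-∀

-- Counting arcs

module GraphCounting {n : ℕ} (G : Graph n) where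

  ｛_｝ : Fin n → VSet n
  ｛ w ｝ v = does (v ≟ w)

  ∁ : VSet n → VSet n
  ∁ X v = not (X v)

  _⊆_ : VSet n → VSet n → Set
  X ⊆ Y = ∀ v → v ∈ X → v ∈ Y

  card : VSet n → ℕ
  card X = sum (λ v → 𝟙 (X v))

  nbrs : VSet n → Fin n → ℕ
  nbrs X v = sum (λ u → 𝟙 (X u) * 𝟙 (adj G v u))

  -- arcs X X is twice the number of edges of G[X].
  arcs : VSet n → VSet n → ℕ
  arcs X Y = sum (λ v → 𝟙 (X v) * nbrs Y v)

  card-cong : ∀ {X Y : VSet n} → X ≗ Y → card X ≡ card Y
  card-cong X≗Y = sum-cong-≗ (λ v → cong 𝟙 (X≗Y v))

  nbrs-cong : ∀ {X Y : VSet n} → X ≗ Y → ∀ v → nbrs X v ≡ nbrs Y v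
  nbrs-cong X≗Y v = sum-cong-≗ (λ u → cong (λ b → 𝟙 b * 𝟙 (adj G v u)) (X≗Y u))

  arcs-cong : ∀ {X X′ Y Y′ : VSet n} → X ≗ X′ → Y ≗ Y′ → arcs X Y ≡ arcs X′ Y′
  arcs-cong X≗X′ Y≗Y′ = sum-cong-≗ (λ v → cong₂ (λ b m → 𝟙 b * m) (X≗X′ v) (nbrs-cong Y≗Y′ v))

  *-distribˡ-nbrs : ∀ c Y v → c * nbrs Y v ≡ sum (λ u → c * (𝟙 (Y u) * 𝟙 (adj G v u)))
  *-distribˡ-nbrs c Y v = *-distribˡ-sum c (λ u → 𝟙 (Y u) * 𝟙 (adj G v u))

  arcs-comm : ∀ X Y → arcs X Y ≡ arcs Y X
  arcs-comm X Y = begin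
    sum (λ v → 𝟙 (X v) * nbrs Y v)
      ≡⟨ sum-cong-≗ (λ v → *-distribˡ-nbrs (𝟙 (X v)) Y v) ⟩
    sum (λ v → sum (λ u → 𝟙 (X v) * (𝟙 (Y u) * 𝟙 (adj G v u))))
      ≡⟨ ∑-comm (λ v u → 𝟙 (X v) * (𝟙 (Y u) * 𝟙 (adj G v u))) ⟩
    sum (λ u → sum (λ v → 𝟙 (X v) * (𝟙 (Y u) * 𝟙 (adj G v u))))
      ≡⟨ sum-cong-≗ (λ u → sum-cong-≗ (λ v → swap (𝟙 (X v)) (𝟙 (Y u)) _ _ (cong 𝟙 (Graph.sym G v u)))) ⟩
    sum (λ u → sum (λ v → 𝟙 (Y u) * (𝟙 (X v) * 𝟙 (adj G u v))))
      ≡⟨ sum-cong-≗ (λ u → *-distribˡ-nbrs (𝟙 (Y u)) X u) ⟨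
    sum (λ u → 𝟙 (Y u) * nbrs X u)
      ∎
    where
    open ≡-Reasoning
    swap : ∀ a b c d → c ≡ d → a * (b * c) ≡ b * (a * d)
    swap a b c .c refl = trans (sym (*-assoc a b c)) (trans (cong (_* c) (*-comm a b)) (*-assoc b a c))

  arcs-even : ∀ X → 2 ∣ arcs X X
  arcs-even X = subst (2 ∣_) (sym (sum-cong-≗ (λ v → *-distribˡ-nbrs (𝟙 (X v)) X v)))
    (sum-symmetric-even (λ v u → 𝟙 (X v) * (𝟙 (X u) * 𝟙 (adj G v u))) symmetric diagonal)
    where
    symmetric : ∀ v u → 𝟙 (X v) * (𝟙 (X u) * 𝟙 (adj G v u)) ≡ 𝟙 (X u) * (𝟙 (X v) * 𝟙 (adj G u v))
    symmetric v u rewrite Graph.sym G v u = trans (sym (*-assoc (𝟙 (X v)) _ _))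
      (trans (cong (_* 𝟙 (adj G u v)) (*-comm (𝟙 (X v)) (𝟙 (X u)))) (*-assoc (𝟙 (X u)) _ _))
    diagonal : ∀ v → 𝟙 (X v) * (𝟙 (X v) * 𝟙 (adj G v v)) ≡ 0
    diagonal v rewrite irrefl G v = trans (cong (𝟙 (X v) *_) (*-zeroʳ (𝟙 (X v)))) (*-zeroʳ (𝟙 (X v)))

  𝟙-∪ : ∀ {X Y : VSet n} → Disjoint X Y → ∀ v → 𝟙 ((X ∪ Y) v) ≡ 𝟙 (X v) + 𝟙 (Y v)
  𝟙-∪ {X} {Y} X#Y v with X v in v∈X | Y v in v∈Y
  ... | true  | true  = ⊥-elim (X#Y v v∈X v∈Y)
  ... | true  | false = refl
  ... | false | _     = refl

  card-∪ : ∀ {X Y : VSet n} → Disjoint X Y → card (X ∪ Y) ≡ card X + card Y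
  card-∪ {X} {Y} X#Y = trans (sum-cong-≗ (𝟙-∪ X#Y)) (∑-distrib-+ (λ v → 𝟙 (X v)) (λ v → 𝟙 (Y v)))

  nbrs-∪ : ∀ {X Y : VSet n} → Disjoint X Y → ∀ v → nbrs (X ∪ Y) v ≡ nbrs X v + nbrs Y v
  nbrs-∪ {X} {Y} X#Y v = trans
    (sum-cong-≗ (λ u → trans (cong (_* 𝟙 (adj G v u)) (𝟙-∪ X#Y u)) (*-distribʳ-+ (𝟙 (adj G v u)) (𝟙 (X u)) (𝟙 (Y u)))))
    (∑-distrib-+ (λ u → 𝟙 (X u) * 𝟙 (adj G v u)) (λ u → 𝟙 (Y u) * 𝟙 (adj G v u)))

  arcs-∪ˡ : ∀ {X Y : VSet n} → Disjoint X Y → ∀ Z → arcs (X ∪ Y) Z ≡ arcs X Z + arcs Y Z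
  arcs-∪ˡ {X} {Y} X#Y Z = trans
    (sum-cong-≗ (λ v → trans (cong (_* nbrs Z v) (𝟙-∪ X#Y v)) (*-distribʳ-+ (nbrs Z v) (𝟙 (X v)) (𝟙 (Y v)))))
    (∑-distrib-+ (λ v → 𝟙 (X v) * nbrs Z v) (λ v → 𝟙 (Y v) * nbrs Z v))

  arcs-∪ʳ : ∀ {Y Z : VSet n} → Disjoint Y Z → ∀ X → arcs X (Y ∪ Z) ≡ arcs X Y + arcs X Z
  arcs-∪ʳ {Y} {Z} Y#Z X = begin
    arcs X (Y ∪ Z)        ≡⟨ arcs-comm X (Y ∪ Z) ⟩
    arcs (Y ∪ Z) X        ≡⟨ arcs-∪ˡ Y#Z X ⟩
    arcs Y X + arcs Z X   ≡⟨ cong₂ _+_ (arcs-comm Y X) (arcs-comm Z X) ⟩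
    arcs X Y + arcs X Z   ∎
    where open ≡-Reasoning

  arcs-∪ : ∀ {X Y : VSet n} → Disjoint X Y → arcs (X ∪ Y) (X ∪ Y) ≡ arcs X X + arcs Y Y + 2 * arcs X Y
  arcs-∪ {X} {Y} X#Y = begin
    arcs (X ∪ Y) (X ∪ Y)                          ≡⟨ arcs-∪ˡ X#Y (X ∪ Y) ⟩
    arcs X (X ∪ Y) + arcs Y (X ∪ Y)               ≡⟨ cong₂ _+_ (arcs-∪ʳ X#Y X) (arcs-∪ʳ X#Y Y) ⟩
    arcs X X + arcs X Y + (arcs Y X + arcs Y Y)   ≡⟨ cong (λ m → arcs X X + arcs X Y + (m + arcs Y Y)) (arcs-comm Y X) ⟩
    arcs X X + arcs X Y + (arcs X Y + arcs Y Y)   ≡⟨ regroup (arcs X X) (arcs X Y) (arcs Y Y) ⟩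
    arcs X X + arcs Y Y + 2 * arcs X Y            ∎
    where
    open ≡-Reasoning
    regroup : ∀ a b c → a + b + (b + c) ≡ a + c + 2 * b
    regroup = solve-∀

  ∁-disjoint : ∀ X → Disjoint X (∁ X)
  ∁-disjoint X v v∈X v∈∁X with X v
  ∁-disjoint X v refl () | true

  ∪-∁ : ∀ X → (X ∪ ∁ X) ≗ full
  ∪-∁ X v with X v
  ... | true  = refl
  ... | false = refl

  card-full : card full ≡ n
  card-full = trans (sum-const n 1) (*-identityʳ n)

  card-∁ : ∀ X → card X + card (∁ X) ≡ n
  card-∁ X = trans (sym (card-∪ (∁-disjoint X))) (trans (card-cong (∪-∁ X)) card-full)

  card≤n : ∀ X → card X ≤ n
  card≤n X = subst (card X ≤_) (card-∁ X) (m≤m+n (card X) (card (∁ X)))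

  arcs-∁ʳ : ∀ X Y → arcs X Y + arcs X (∁ Y) ≡ arcs X full
  arcs-∁ʳ X Y = trans (sym (arcs-∪ʳ (∁-disjoint Y) X)) (arcs-cong {X} {X} (λ _ → refl) (∪-∁ Y))

  degree≡nbrs-full : ∀ v → degree G v ≡ nbrs full v
  degree≡nbrs-full v = begin
    sumᴸ (mapᴸ indicator (allFin n)) ≡⟨ cong sumᴸ (map-tabulate (λ u → u) indicator) ⟩
    sumᴸ (tabulate indicator)                ≡⟨ sumᴸ-tabulate indicator ⟩
    sum indicator                            ≡⟨ sum-cong-≗ (λ u → if-𝟙 (adj G v u)) ⟩
    nbrs full v                              ∎
    where
    open ≡-Reasoning
    indicator : Fin n → ℕ
    indicator u = if adj G v u then 1 else 0
    if-𝟙 : ∀ b → (if b then 1 else 0) ≡ 1 * 𝟙 b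
    if-𝟙 true  = refl
    if-𝟙 false = refl

  arcs-full≤ : ∀ {d} → (∀ v → degree G v ≤ d) → ∀ X → arcs X full ≤ d * card X
  arcs-full≤ {d} deg≤d X = begin
    sum (λ v → 𝟙 (X v) * nbrs full v) ≤⟨ sum-mono-≤ (λ v → *-monoʳ-≤ (𝟙 (X v)) (nbrs-full≤ v)) ⟩
    sum (λ v → 𝟙 (X v) * d)          ≡⟨ sum-cong-≗ (λ v → *-comm (𝟙 (X v)) d) ⟩
    sum (λ v → d * 𝟙 (X v))          ≡⟨ *-distribˡ-sum d (λ v → 𝟙 (X v)) ⟨
    d * card X                       ∎
    where
    open ≤-Reasoning
    nbrs-full≤ : ∀ v → nbrs full v ≤ d
    nbrs-full≤ v = subst (_≤ d) (degree≡nbrs-full v) (deg≤d v)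

  nbrs-pos : ∀ {X : VSet n} {v u} → u ∈ X → adj G v u ≡ true → 1 ≤ nbrs X v
  nbrs-pos {X} {v} {u} u∈X vu = subst (λ m → m ≤ nbrs X v) one
    (≤-sum (λ w → 𝟙 (X w) * 𝟙 (adj G v w)) u)
    where
    one : 𝟙 (X u) * 𝟙 (adj G v u) ≡ 1
    one rewrite u∈X | vu = refl

  nbrs-｛｝ : ∀ w v → nbrs ｛ w ｝ v ≡ 𝟙 (adj G v w)
  nbrs-｛｝ w v = sum-point w (λ u → 𝟙 (adj G v u))

  arcs-｛｝ : ∀ w Y → arcs ｛ w ｝ Y ≡ nbrs Y w
  arcs-｛｝ w Y = sum-point w (nbrs Y)

  card-｛｝ : ∀ w → card ｛ w ｝ ≡ 1
  card-｛｝ w = trans (sum-cong-≗ (λ v → sym (*-identityʳ (𝟙 (｛ w ｝ v))))) (sum-point w (λ _ → 1))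

  arcs-｛｝-｛｝ : ∀ w → arcs ｛ w ｝ ｛ w ｝ ≡ 0
  arcs-｛｝-｛｝ w = trans (arcs-｛｝ w ｛ w ｝) (trans (nbrs-｛｝ w w) (cong 𝟙 (irrefl G w)))

  reach-exit : ∀ {S} {P : Fin n → Set} → Decidable P → ∀ {u v} → Reach G S u v → P u → ¬ P v →
               Σ (Fin n) λ y → Σ (Fin n) λ z → P y × ¬ P z × z ∈ S × adj G y z ≡ true
  reach-exit P? here Pu ¬Pv = ⊥-elim (¬Pv Pu)
  reach-exit P? (step {u} {w} uw w∈S w⇝v) Pu ¬Pv with P? w
  ... | no  ¬Pw = u , w , Pu , ¬Pw , w∈S , uw
  ... | yes Pw  = reach-exit P? w⇝v Pw ¬Pv

  ∉⇒#｛｝ : ∀ {X : VSet n} {z} → ¬ z ∈ X → Disjoint X ｛ z ｝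
  ∉⇒#｛｝ {X} {z} z∉X v v∈X v∈z with v ≟ z
  ∉⇒#｛｝ z∉X v v∈X refl | yes refl = z∉X v∈X

  card-∪-｛｝ : ∀ {X : VSet n} {z} → ¬ z ∈ X → card (X ∪ ｛ z ｝) ≡ suc (card X)
  card-∪-｛｝ {X} {z} z∉X =
    trans (card-∪ {X} {｛ z ｝} (∉⇒#｛｝ z∉X)) (trans (cong (card X +_) (card-｛｝ z)) (+-comm (card X) 1))

  arcs-∪-｛｝ : ∀ {X : VSet n} {z} → ¬ z ∈ X → arcs (X ∪ ｛ z ｝) (X ∪ ｛ z ｝) ≡ arcs X X + 2 * nbrs X z
  arcs-∪-｛｝ {X} {z} z∉X = begin
    arcs (X ∪ ｛ z ｝) (X ∪ ｛ z ｝)                    ≡⟨ arcs-∪ {X} {｛ z ｝} (∉⇒#｛｝ z∉X) ⟩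
    arcs X X + arcs ｛ z ｝ ｛ z ｝ + 2 * arcs X ｛ z ｝ ≡⟨ cong₂ (λ a b → arcs X X + a + 2 * b) (arcs-｛｝-｛｝ z) arcs-X-z ⟩
    arcs X X + 0 + 2 * nbrs X z                        ≡⟨ cong (_+ 2 * nbrs X z) (+-identityʳ (arcs X X)) ⟩
    arcs X X + 2 * nbrs X z                            ∎
    where
    open ≡-Reasoning
    arcs-X-z : arcs X ｛ z ｝ ≡ nbrs X z
    arcs-X-z = trans (arcs-comm X ｛ z ｝) (arcs-｛｝ z X)

  module _ (S : VSet n) (connected : InducedConnected G S) where

    -- The fuel k bounds the number of vertices still missing from X.
    private
      grow : ∀ k X x → X ⊆ S → x ∈ X → n ≤ k + card X → arcs X X + 2 * card S ≤ arcs S S + 2 * card X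
      grow k X x X⊆S x∈X fuel with any? (λ w → (S w ≟ᵇ true) ×-dec (X w ≟ᵇ false))
      ... | no S⊆X = ≤-reflexive (cong₂ (λ a c → a + 2 * c) (arcs-cong X≗S X≗S) (card-cong (λ v → sym (X≗S v))))
        where
        X≗S : X ≗ S
        X≗S v with X v in v∈X | S v in v∈S
        ... | true  | true  = refl
        ... | false | false = refl
        ... | true  | false = trans (sym (X⊆S v v∈X)) v∈S
        ... | false | true  = ⊥-elim (S⊆X (v , v∈S , v∈X))
      ... | yes (w , w∈S , w∉X) with reach-exit (λ v → X v ≟ᵇ true) (connected x w (X⊆S x x∈X) w∈S) x∈X
                                        (λ w∈X → case trans (sym w∈X) w∉X of λ ())
      ... | y , z , y∈X , z∉X , z∈S , yz = add-z k fuel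
        where
        X⊆S′ : (X ∪ ｛ z ｝) ⊆ S
        X⊆S′ v v∈X′ with X v in v∈X | v ≟ z
        ... | true  | _        = X⊆S v v∈X
        ... | false | yes refl = z∈S
        card-X+z : card (X ∪ ｛ z ｝) ≡ suc (card X)
        card-X+z = card-∪-｛｝ {X} {z} z∉X
        add-z : ∀ k → n ≤ k + card X → arcs X X + 2 * card S ≤ arcs S S + 2 * card X
        add-z zero    fuel = ⊥-elim (<⇒≱ (subst (_≤ n) card-X+z (card≤n (X ∪ ｛ z ｝))) fuel)
        add-z (suc k) fuel = +-cancelʳ-≤ 2 _ _ (begin
          arcs X X + 2 * card S + 2                    ≤⟨ +-monoʳ-≤ _ (*-monoʳ-≤ 2 (nbrs-pos {X} y∈X (trans (Graph.sym G z y) yz))) ⟩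
          arcs X X + 2 * card S + 2 * nbrs X z         ≡⟨ swap-last (arcs X X) (2 * card S) (2 * nbrs X z) ⟩
          arcs X X + 2 * nbrs X z + 2 * card S         ≡⟨ cong (_+ 2 * card S) (arcs-∪-｛｝ {X} {z} z∉X) ⟨
          arcs (X ∪ ｛ z ｝) (X ∪ ｛ z ｝) + 2 * card S  ≤⟨ grow k (X ∪ ｛ z ｝) x X⊆S′ (cong (_∨ ｛ z ｝ x) x∈X) fuel′ ⟩
          arcs S S + 2 * card (X ∪ ｛ z ｝)              ≡⟨ cong (λ c → arcs S S + 2 * c) card-X+z ⟩
          arcs S S + 2 * (1 + card X)                  ≡⟨ distribute (arcs S S) (card X) ⟩
          arcs S S + 2 * card X + 2                    ∎)
          where
          open ≤-Reasoning
          fuel′ : n ≤ k + card (X ∪ ｛ z ｝)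
          fuel′ = subst (n ≤_) (trans (sym (+-suc k (card X))) (cong (k +_) (sym card-X+z))) fuel
          swap-last : ∀ a b c → a + b + c ≡ a + c + b
          swap-last = solve-∀
          distribute : ∀ a c → a + 2 * (1 + c) ≡ a + 2 * c + 2
          distribute = solve-∀

    arcs-growth : ∀ X x → X ⊆ S → x ∈ X → arcs X X + 2 * card S ≤ arcs S S + 2 * card X
    arcs-growth X x X⊆S x∈X = grow n X x X⊆S x∈X (m≤m+n n (card X))

    arcs-connected : ∀ x → x ∈ S → 2 * card S ≤ arcs S S + 2
    arcs-connected x x∈S = subst₂ _≤_ (cong (_+ 2 * card S) (arcs-｛｝-｛｝ x)) (cong (λ c → arcs S S + 2 * c) (card-｛｝ x))
      (arcs-growth ｛ x ｝ x singleton⊆S (x≡x x))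
      where
      x≡x : ∀ x → x ∈ ｛ x ｝
      x≡x x with x ≟ x
      ... | yes _  = refl
      ... | no x≢x = ⊥-elim (x≢x refl)
      singleton⊆S : ｛ x ｝ ⊆ S
      singleton⊆S v v∈｛x｝ with v ≟ x
      singleton⊆S v refl | yes refl = x∈S

  dominating-nbrs : ∀ {U v} → Dominating G U → U v ≡ false → 1 ≤ nbrs U v
  dominating-nbrs {U} {v} dom v∉U with dom v (λ v∈U → case trans (sym v∈U) v∉U of λ ())
  ... | u , u∈U , vu = nbrs-pos {U} u∈U vu

  card-∁≤arcs : ∀ {U} → Dominating G U → card (∁ U) ≤ arcs (∁ U) U
  card-∁≤arcs {U} dom = sum-mono-≤ outside
    where
    outside : ∀ v → 𝟙 (∁ U v) ≤ 𝟙 (∁ U v) * nbrs U v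
    outside v with U v in v∈U
    ... | true  = z≤n
    ... | false = subst (1 ≤_) (sym (+-identityʳ (nbrs U v))) (dominating-nbrs dom v∈U)

  cds-order : (∀ v → degree G v ≤ 3) → ∀ {U u} → IsCDS G U → u ∈ U → n ≤ 2 * card U + 2
  cds-order deg≤3 {U} {u} (dom , conn) u∈U = +-cancelʳ-≤ (2 * card U) _ _ (begin
    n + 2 * card U                                     ≡⟨ cong (_+ 2 * card U) (card-∁ U) ⟨
    card U + card (∁ U) + 2 * card U                   ≤⟨ +-monoˡ-≤ _ (+-monoʳ-≤ (card U) (card-∁≤arcs dom)) ⟩
    card U + arcs (∁ U) U + 2 * card U                 ≤⟨ +-monoʳ-≤ (card U + arcs (∁ U) U) (arcs-connected U conn u u∈U) ⟩
    card U + arcs (∁ U) U + (arcs U U + 2)             ≡⟨ cong (λ a → card U + a + (arcs U U + 2)) (arcs-comm (∁ U) U) ⟩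
    card U + arcs U (∁ U) + (arcs U U + 2)             ≡⟨ regroup (card U) (arcs U (∁ U)) (arcs U U) ⟩
    card U + (arcs U U + arcs U (∁ U)) + 2             ≡⟨ cong (λ a → card U + a + 2) (arcs-∁ʳ U U) ⟩
    card U + arcs U full + 2                           ≤⟨ +-monoˡ-≤ 2 (+-monoʳ-≤ (card U) (arcs-full≤ deg≤3 U)) ⟩
    card U + 3 * card U + 2                            ≡⟨ regroup′ (card U) ⟩
    2 * card U + 2 + 2 * card U                        ∎)
    where
    open ≤-Reasoning
    regroup : ∀ c a b → c + a + (b + 2) ≡ c + (b + a) + 2
    regroup = solve-∀
    regroup′ : ∀ c → c + 3 * c + 2 ≡ 2 * c + 2 + 2 * c
    regroup′ = solve-∀

  cds-family-order : (∀ v → degree G v ≤ 3) → ∀ {r} (U : Fin r → VSet n) →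
                     (∀ k → IsCDS G (U k)) → (∀ k → ∃ λ u → u ∈ U k) →
                     r * n ≤ 2 * sum (λ k → card (U k)) + 2 * r
  cds-family-order deg≤3 {r} U cds nonempty = begin
    r * n                                   ≡⟨ sum-const r n ⟨
    sum {r} (λ _ → n)                       ≤⟨ sum-mono-≤ (λ k → cds-order deg≤3 (cds k) (proj₂ (nonempty k))) ⟩
    sum (λ k → 2 * card (U k) + 2)          ≡⟨ ∑-distrib-+ (λ k → 2 * card (U k)) (λ _ → 2) ⟩
    sum (λ k → 2 * card (U k)) + sum {r} (λ _ → 2)
                                            ≡⟨ cong₂ _+_ (sym (*-distribˡ-sum 2 (λ k → card (U k)))) (trans (sum-const r 2) (*-comm r 2)) ⟩
    2 * sum (λ k → card (U k)) + 2 * r      ∎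
    where open ≤-Reasoning

class : ∀ {n m} → (Fin n → Fin m) → Fin m → VSet n
class p c v = does (p v ≟ c)

-- What the upper bounds use of CCG(G , π) ≅ H: the classes relabelled by the vertices of H are
-- nonempty, and every edge of H joins two classes whose union is a connected dominating set.
record CoalitionLabelling {n} (G : Graph n) {m} (H : Fin m → Fin m → Bool) : Set where
  field
    label         : Fin n → Fin m
    label-onto    : ∀ c → ∃ λ v → label v ≡ c
    coalition-cds : ∀ i j → H i j ≡ true → IsCDS G (class label i ∪ class label j)

coalition⇒cds-∪ : ∀ {n} {G : Graph n} {A B : VSet n} → ConnCoalition G A B → IsCDS G (A ∪ B)
coalition⇒cds-∪ (_ , _ , _ , cds) = cds

IsCDS-cong : ∀ {n} {G : Graph n} {X Y : VSet n} → X ≗ Y → IsCDS G X → IsCDS G Y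
IsCDS-cong {G = G} {X} {Y} X≗Y (dom , conn) = dom′ , λ u v u∈Y v∈Y → transport (conn u v (∈Y⇒∈X u∈Y) (∈Y⇒∈X v∈Y))
  where
  ∈Y⇒∈X : ∀ {v} → v ∈ Y → v ∈ X
  ∈Y⇒∈X {v} = trans (X≗Y v)
  dom′ : Dominating G Y
  dom′ v v∉Y with dom v (λ v∈X → v∉Y (trans (sym (X≗Y v)) v∈X))
  ... | u , u∈X , vu = u , trans (sym (X≗Y u)) u∈X , vu
  transport : ∀ {u v} → Reach G X u v → Reach G Y u v
  transport here            = here
  transport (step uw w∈X r) = step uw (trans (sym (X≗Y _)) w∈X) (transport r)

ccgIso⇒labelling : ∀ {n k m} {G : Graph n} {π : Partition n k} (H : Fin m → Fin m → Bool) →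
                   CCGIso G π H → CoalitionLabelling G H
ccgIso⇒labelling {n} {k} {m} {G} {π} H (σ , iso) = record
  { label = label ; label-onto = label-onto ; coalition-cds = coalition-cds }
  where
  open Inverse σ using (to; from; strictlyInverseˡ; strictlyInverseʳ)
  label : Fin n → Fin m
  label v = to (part π v)
  label-onto : ∀ c → ∃ λ v → label v ≡ c
  label-onto c with nonempty π (from c)
  ... | v , v∈c = v , trans (cong to v∈c) (strictlyInverseˡ c)
  cls≗class : ∀ c → cls π (from c) ≗ class label c
  cls≗class c v = trans (isYes≗does (part π v ≟ from c)) (does-⇔ same-class (part π v ≟ from c) (label v ≟ c))
    where
    same-class : (part π v ≡ from c) ⇔ (label v ≡ c)
    same-class = mk⇔ (λ e → trans (cong to e) (strictlyInverseˡ c))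
                     (λ e → trans (sym (strictlyInverseʳ (part π v))) (cong from e))
  coalition-cds : ∀ i j → H i j ≡ true → IsCDS G (class label i ∪ class label j)
  coalition-cds i j Hij = IsCDS-cong (λ v → cong₂ _∨_ (cls≗class i v) (cls≗class j v))
    (coalition⇒cds-∪ (proj₂ (iso (from i) (from j)) Hij′))
    where
    Hij′ : H (to (from i)) (to (from j)) ≡ true
    Hij′ = subst₂ (λ a b → H a b ≡ true) (sym (strictlyInverseˡ i)) (sym (strictlyInverseˡ j)) Hij

module Classes {n m} (G : Graph n) (p : Fin n → Fin m) where
  open GraphCounting G

  V : Fin m → VSet n
  V = class p

  size : Fin m → ℕ
  size c = card (V c)

  ∈V : ∀ {v c} → p v ≡ c → v ∈ V c
  ∈V {v} refl with p v ≟ p v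
  ... | yes _    = refl
  ... | no  ≢pv = ⊥-elim (≢pv refl)

  ∈V⇒≡ : ∀ {v c} → v ∈ V c → p v ≡ c
  ∈V⇒≡ {v} {c} v∈c with p v ≟ c
  ... | yes pv≡c = pv≡c

  V-disjoint : ∀ {i j} → i ≢ j → Disjoint (V i) (V j)
  V-disjoint i≢j v v∈i v∈j = i≢j (trans (sym (∈V⇒≡ v∈i)) (∈V⇒≡ v∈j))

  size-∪ : ∀ {i j} → i ≢ j → card (V i ∪ V j) ≡ size i + size j
  size-∪ i≢j = card-∪ (V-disjoint i≢j)

  sum-V : ∀ v (g : Fin m → ℕ) → sum (λ c → 𝟙 (V c v) * g c) ≡ g (p v)
  sum-V v g = trans (sum-cong-≗ (λ c → cong (λ b → 𝟙 b * g c) (does-⇔ (mk⇔ sym sym) (p v ≟ c) (c ≟ p v))))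
                    (sum-point (p v) g)

  order≡∑size : n ≡ sum size
  order≡∑size = begin
    n                                              ≡⟨ card-full ⟨
    sum {n} (λ _ → 1)                              ≡⟨ sum-cong-≗ (λ v → sym (sum-V v (λ _ → 1))) ⟩
    sum (λ v → sum (λ c → 𝟙 (V c v) * 1))          ≡⟨ ∑-comm (λ v c → 𝟙 (V c v) * 1) ⟩
    sum (λ c → sum (λ v → 𝟙 (V c v) * 1))          ≡⟨ sum-cong-≗ (λ c → sum-cong-≗ (λ v → *-identityʳ (𝟙 (V c v)))) ⟩
    sum size                                       ∎
    where open ≡-Reasoning

  sum-nbrs-V : ∀ v → sum (λ c → nbrs (V c) v) ≡ nbrs full v
  sum-nbrs-V v = begin
    sum (λ c → sum (λ u → 𝟙 (V c u) * 𝟙 (adj G v u)))  ≡⟨ ∑-comm (λ c u → 𝟙 (V c u) * 𝟙 (adj G v u)) ⟩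
    sum (λ u → sum (λ c → 𝟙 (V c u) * 𝟙 (adj G v u)))  ≡⟨ sum-cong-≗ (λ u → trans (sum-V u (λ _ → 𝟙 (adj G v u))) (sym (*-identityˡ _))) ⟩
    nbrs full v                                         ∎
    where open ≡-Reasoning

  sum-arcs-V : ∀ X → sum (λ c → arcs X (V c)) ≡ arcs X full
  sum-arcs-V X = begin
    sum (λ c → sum (λ v → 𝟙 (X v) * nbrs (V c) v))  ≡⟨ ∑-comm (λ c v → 𝟙 (X v) * nbrs (V c) v) ⟩
    sum (λ v → sum (λ c → 𝟙 (X v) * nbrs (V c) v))  ≡⟨ sum-cong-≗ (λ v → sym (*-distribˡ-sum (𝟙 (X v)) (λ c → nbrs (V c) v))) ⟩
    sum (λ v → 𝟙 (X v) * sum (λ c → nbrs (V c) v))  ≡⟨ sum-cong-≗ (λ v → cong (𝟙 (X v) *_) (sum-nbrs-V v)) ⟩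
    arcs X full                                      ∎
    where open ≡-Reasoning

  ∉V : ∀ {v c} → p v ≢ c → V c v ≡ false
  ∉V {v} {c} pv≢c with p v ≟ c
  ... | yes pv≡c = ⊥-elim (pv≢c pv≡c)
  ... | no  _    = refl

  ∈V⇒∉V : ∀ {v i j} → v ∈ V i → i ≢ j → V j v ≡ false
  ∈V⇒∉V v∈i i≢j = ∉V (λ pv≡j → i≢j (trans (sym (∈V⇒≡ v∈i)) pv≡j))

  inhabited : (∀ c → ∃ λ v → p v ≡ c) → ∀ c → ∃ λ v → v ∈ V c
  inhabited onto c with onto c
  ... | v , pv≡c = v , ∈V pv≡c

-- Edgeless H, C₅, 3K₂ and K₃,₃

edgeless-order : ∀ {n k m} {G : Graph n} {π : Partition n k} (H : Fin m → Fin m → Bool) →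
                 (∀ i j → H i j ≡ false) → IsCCP G π → CCGIso G π H → n ≤ m
edgeless-order {π = π} H no-edge ccp (σ , iso) = injective⇒≤ label-injective
  where
  open Inverse σ using (to; from; strictlyInverseʳ)
  singleton : ∀ i → Singleton (cls π i)
  singleton i with ccp i
  ... | inj₁ (_ , single)       = single
  ... | inj₂ (j , _ , coalition) = case trans (sym (proj₁ (iso i j) coalition)) (no-edge _ _) of λ ()
  own-class : ∀ v → v ∈ cls π (part π v)
  own-class v with part π v ≟ part π v
  ... | yes _   = refl
  ... | no  ≢pv = ⊥-elim (≢pv refl)
  label-injective : ∀ {v w} → to (part π v) ≡ to (part π w) → v ≡ w
  label-injective {v} {w} same-label = trans (only v (own-class v)) (sym (only w w∈class))
    where
    only : ∀ u → u ∈ cls π (part π v) → u ≡ proj₁ (singleton (part π v))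
    only = proj₂ (proj₂ (singleton (part π v)))
    same-part : part π w ≡ part π v
    same-part = trans (sym (strictlyInverseʳ _)) (trans (cong from (sym same-label)) (strictlyInverseʳ _))
    w∈class : w ∈ cls π (part π v)
    w∈class = subst (λ c → w ∈ cls π c) same-part (own-class w)

module _ {n m} {G : Graph n} {H : Fin m → Fin m → Bool} (deg≤3 : ∀ v → degree G v ≤ 3)
         (L : CoalitionLabelling G H) where
  open CoalitionLabelling L
  open GraphCounting G
  open Classes G label

  coalition-family-order : ∀ {r} (e₁ e₂ : Fin r → Fin m) → (∀ k → e₁ k ≢ e₂ k) → (∀ k → H (e₁ k) (e₂ k) ≡ true) →
                           r * n ≤ 2 * sum (λ k → size (e₁ k) + size (e₂ k)) + 2 * r
  coalition-family-order {r} e₁ e₂ e₁≢e₂ edge =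
    subst (λ s → r * n ≤ 2 * s + 2 * r) (sum-cong-≗ (λ k → size-∪ (e₁≢e₂ k)))
      (cds-family-order deg≤3 (λ k → V (e₁ k) ∪ V (e₂ k)) (λ k → coalition-cds _ _ (edge k)) inhabited∪)
    where
    inhabited∪ : ∀ k → ∃ λ u → u ∈ (V (e₁ k) ∪ V (e₂ k))
    inhabited∪ k with inhabited label-onto (e₁ k)
    ... | u , u∈e₁ = u , cong (_∨ V (e₂ k) u) u∈e₁

cancel-multiple : ∀ a {n c} → suc a * n ≤ a * n + c → n ≤ c
cancel-multiple a {n} {c} le = +-cancelˡ-≤ (a * n) n c (subst (_≤ a * n + c) (+-comm n (a * n)) le)

C5-order : ∀ {n} {G : Graph n} → (∀ v → degree G v ≤ 3) → CoalitionLabelling G (adjOf C5) → n ≤ 10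
C5-order {n} {G} deg≤3 L = cancel-multiple 4 (subst (λ s → 5 * n ≤ s + 10) cycle-count
  (coalition-family-order deg≤3 L (λ i → i) next next≢ edge))
  where
  open Classes G (CoalitionLabelling.label L)
  next : Fin 5 → Fin 5
  next 0F = 1F
  next 1F = 2F
  next 2F = 3F
  next 3F = 4F
  next 4F = 0F
  next≢ : ∀ i → i ≢ next i
  next≢ 0F ()
  next≢ 1F ()
  next≢ 2F ()
  next≢ 3F ()
  next≢ 4F ()
  edge : ∀ i → adjOf C5 i (next i) ≡ true
  edge 0F = refl
  edge 1F = refl
  edge 2F = refl
  edge 3F = refl
  edge 4F = refl
  twice : ∀ a b c d e → 2 * (a + b + (b + c + (c + d + (d + e + (e + a + 0))))) ≡ 4 * (a + (b + (c + (d + (e + 0)))))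
  twice = solve-∀
  cycle-count : 2 * sum (λ i → size i + size (next i)) ≡ 4 * n
  cycle-count = trans (twice (size 0F) (size 1F) (size 2F) (size 3F) (size 4F)) (cong (4 *_) (sym order≡∑size))

threeK2-order : ∀ {n} {G : Graph n} → (∀ v → degree G v ≤ 3) → CoalitionLabelling G (adjOf threeK2) → n ≤ 6
threeK2-order {n} {G} deg≤3 L =
  cancel-multiple 2 (subst (λ s → 3 * n ≤ 2 * s + 6) covers (coalition-family-order deg≤3 L e₁ e₂ e₁≢e₂ edge))
  where
  open Classes G (CoalitionLabelling.label L)
  e₁ e₂ : Fin 3 → Fin 6
  e₁ 0F = 0F
  e₁ 1F = 2F
  e₁ 2F = 4F
  e₂ 0F = 1F
  e₂ 1F = 3F
  e₂ 2F = 5F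
  e₁≢e₂ : ∀ k → e₁ k ≢ e₂ k
  e₁≢e₂ 0F ()
  e₁≢e₂ 1F ()
  e₁≢e₂ 2F ()
  edge : ∀ k → adjOf threeK2 (e₁ k) (e₂ k) ≡ true
  edge 0F = refl
  edge 1F = refl
  edge 2F = refl
  regroup : ∀ a b c d e f → a + b + (c + d + (e + f + 0)) ≡ a + (b + (c + (d + (e + (f + 0)))))
  regroup = solve-∀
  covers : sum (λ k → size (e₁ k) + size (e₂ k)) ≡ n
  covers = trans (regroup (size 0F) (size 1F) (size 2F) (size 3F) (size 4F) (size 5F)) (sym order≡∑size)

K33-order : ∀ {n} {G : Graph n} → (∀ v → degree G v ≤ 3) → CoalitionLabelling G (adjOf K33) → n ≤ 6
K33-order {n} {G} deg≤3 L =
  cancel-multiple 2 (subst (λ s → 3 * n ≤ 2 * s + 6) covers (coalition-family-order deg≤3 L e₁ e₂ e₁≢e₂ edge))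
  where
  open Classes G (CoalitionLabelling.label L)
  e₁ e₂ : Fin 3 → Fin 6
  e₁ 0F = 0F
  e₁ 1F = 1F
  e₁ 2F = 2F
  e₂ 0F = 3F
  e₂ 1F = 4F
  e₂ 2F = 5F
  e₁≢e₂ : ∀ k → e₁ k ≢ e₂ k
  e₁≢e₂ 0F ()
  e₁≢e₂ 1F ()
  e₁≢e₂ 2F ()
  edge : ∀ k → adjOf K33 (e₁ k) (e₂ k) ≡ true
  edge 0F = refl
  edge 1F = refl
  edge 2F = refl
  regroup : ∀ a b c d e f → a + d + (b + e + (c + f + 0)) ≡ a + (b + (c + (d + (e + (f + 0)))))
  regroup = solve-∀
  covers : sum (λ k → size (e₁ k) + size (e₂ k)) ≡ n
  covers = trans (regroup (size 0F) (size 1F) (size 2F) (size 3F) (size 4F) (size 5F)) (sym order≡∑size)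

-- K₄

K4-edge : ∀ {i j : Fin 4} → i ≢ j → adjOf K4 i j ≡ true
K4-edge {i} {j} i≢j = not-≡ᵇ (i≢j ∘ toℕ-injective)
  where
  not-≡ᵇ : ∀ {a b} → a ≢ b → not (a ≡ᵇ b) ≡ true
  not-≡ᵇ {a} {b} a≢b with a ≡ᵇ b in a≡ᵇb
  ... | true  = ⊥-elim (a≢b (≡ᵇ⇒≡ a b (subst T (sym a≡ᵇb) tt)))
  ... | false = refl

two-of-three : ∀ {a b c} → 1 ≤ a + b → 1 ≤ a + c → 1 ≤ b + c → 2 ≤ a + (b + (c + 0))
two-of-three {zero}  {b} {c} ab ac bc = ≤-trans (+-mono-≤ ab ac) (≤-reflexive (cong (b +_) (sym (+-identityʳ c))))
two-of-three {suc a} {b} {c} ab ac bc = s≤s (≤-trans bc (≤-trans (≤-reflexive (cong (b +_) (sym (+-identityʳ c)))) (m≤n+m _ a)))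

at-least-3 : ∀ {s A φ} → φ ≤ s → A ≤ φ + 6 → 11 ≤ s + A → 3 ≤ s
at-least-3 {s} {A} {φ} φ≤s A≤φ+6 11≤s+A = three (≤-trans 11≤s+A (+-monoʳ-≤ s (≤-trans A≤φ+6 (+-monoˡ-≤ 6 φ≤s))))
  where
  three : ∀ {s} → 11 ≤ s + (s + 6) → 3 ≤ s
  three {0}                 le = ⊥-elim (≤⇒≤ᵇ le)
  three {1}                 le = ⊥-elim (≤⇒≤ᵇ le)
  three {2}                 le = ⊥-elim (≤⇒≤ᵇ le)
  three {suc (suc (suc s))} _  = s≤s (s≤s (s≤s z≤n))

at-most-3 : ∀ {s₀ s₁ s₂ s₃ φ₁ φ₂ φ₃} → φ₁ ≤ s₁ → φ₂ ≤ s₂ → φ₃ ≤ s₃ → 9 ≤ s₁ + (s₂ + (s₃ + 0)) →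
            s₀ + (s₂ + (s₃ + 0)) ≤ φ₁ + 6 → s₀ + (s₁ + (s₃ + 0)) ≤ φ₂ + 6 → s₀ + (s₁ + (s₂ + 0)) ≤ φ₃ + 6 →
            s₀ ≤ 3
at-most-3 {s₀} {s₁} {s₂} {s₃} {φ₁} {φ₂} {φ₃} φ₁≤s₁ φ₂≤s₂ φ₃≤s₃ 9≤r o₁ o₂ o₃ =
  *-cancelˡ-≤ 3 (+-cancelʳ-≤ 9 (3 * s₀) 9 (+-cancelʳ-≤ r _ _ (begin
    3 * s₀ + 9 + r                                                         ≤⟨ +-monoˡ-≤ r (+-monoʳ-≤ (3 * s₀) 9≤r) ⟩
    3 * s₀ + r + r                                                         ≡⟨ spread s₀ s₁ s₂ s₃ ⟩
    s₀ + (s₂ + (s₃ + 0)) + (s₀ + (s₁ + (s₃ + 0)) + (s₀ + (s₁ + (s₂ + 0)))) ≤⟨ +-mono-≤ o₁ (+-mono-≤ o₂ o₃) ⟩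
    φ₁ + 6 + (φ₂ + 6 + (φ₃ + 6))
      ≤⟨ +-mono-≤ (+-monoˡ-≤ 6 φ₁≤s₁) (+-mono-≤ (+-monoˡ-≤ 6 φ₂≤s₂) (+-monoˡ-≤ 6 φ₃≤s₃)) ⟩
    s₁ + 6 + (s₂ + 6 + (s₃ + 6))                                           ≡⟨ collect s₁ s₂ s₃ ⟩
    9 + 9 + r                                                              ∎)))
  where
  open ≤-Reasoning
  r : ℕ
  r = s₁ + (s₂ + (s₃ + 0))
  spread : ∀ a b c d → 3 * a + (b + (c + (d + 0))) + (b + (c + (d + 0)))
                       ≡ a + (c + (d + 0)) + (a + (b + (d + 0)) + (a + (b + (c + 0))))
  spread = solve-∀
  collect : ∀ b c d → b + 6 + (c + 6 + (d + 6)) ≡ 9 + 9 + (b + (c + (d + 0)))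
  collect = solve-∀

-- If n ≥ 11, every class has at least 3 vertices, which pins |V₀| = φ₀ = 3 against the parity of φ₀.
K4-arithmetic : ∀ {s₀ s₁ s₂ s₃ φ₀ φ₁ φ₂ φ₃} →
  φ₀ ≤ s₀ → φ₁ ≤ s₁ → φ₂ ≤ s₂ → φ₃ ≤ s₃ →
  s₁ + (s₂ + (s₃ + 0)) ≤ φ₀ + 6 → s₀ + (s₂ + (s₃ + 0)) ≤ φ₁ + 6 →
  s₀ + (s₁ + (s₃ + 0)) ≤ φ₂ + 6 → s₀ + (s₁ + (s₂ + 0)) ≤ φ₃ + 6 →
  2 ∣ φ₀ → s₀ + (s₁ + (s₂ + (s₃ + 0))) ≤ 10
K4-arithmetic {s₀} {s₁} {s₂} {s₃} {φ₀} φ₀≤s₀ φ₁≤s₁ φ₂≤s₂ φ₃≤s₃ o₀ o₁ o₂ o₃ 2∣φ₀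
  with s₀ + (s₁ + (s₂ + (s₃ + 0))) ≤? 10
... | yes n≤10 = n≤10
... | no  n≰10 = ⊥-elim (from-no (2 ∣? 3) (subst (2 ∣_) φ₀≡3 2∣φ₀))
  where
  11≤n : 11 ≤ s₀ + (s₁ + (s₂ + (s₃ + 0)))
  11≤n = ≰⇒> n≰10
  front₁ : ∀ a b c d → a + (b + (c + (d + 0))) ≡ b + (a + (c + (d + 0)))
  front₁ = solve-∀
  front₂ : ∀ a b c d → a + (b + (c + (d + 0))) ≡ c + (a + (b + (d + 0)))
  front₂ = solve-∀
  front₃ : ∀ a b c d → a + (b + (c + (d + 0))) ≡ d + (a + (b + (c + 0)))
  front₃ = solve-∀
  9≤rest : 9 ≤ s₁ + (s₂ + (s₃ + 0))
  9≤rest = +-mono-≤ (at-least-3 φ₁≤s₁ o₁ (subst (11 ≤_) (front₁ s₀ s₁ s₂ s₃) 11≤n))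
          (+-mono-≤ (at-least-3 φ₂≤s₂ o₂ (subst (11 ≤_) (front₂ s₀ s₁ s₂ s₃) 11≤n))
          (+-mono-≤ (at-least-3 φ₃≤s₃ o₃ (subst (11 ≤_) (front₃ s₀ s₁ s₂ s₃) 11≤n)) z≤n))
  φ₀≡3 : φ₀ ≡ 3
  φ₀≡3 = ≤-antisym (≤-trans φ₀≤s₀ (at-most-3 φ₁≤s₁ φ₂≤s₂ φ₃≤s₃ 9≤rest o₁ o₂ o₃)) (+-cancelʳ-≤ 6 3 φ₀ (≤-trans 9≤rest o₀))

module K4-Bound {n} {G : Graph n} (deg≤3 : ∀ v → degree G v ≤ 3) (L : CoalitionLabelling G (adjOf K4)) where
  open CoalitionLabelling L
  open GraphCounting G
  open Classes G label

  φ : Fin 4 → ℕ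
  φ c = arcs (V c) (V c)

  cds : ∀ {i j} → i ≢ j → IsCDS G (V i ∪ V j)
  cds i≢j = coalition-cds _ _ (K4-edge i≢j)

  -- A vertex must see two of the other three classes to be dominated by each pair of them.
  own-class-nbrs≤1 : ∀ v → nbrs (V (label v)) v ≤ 1
  own-class-nbrs≤1 v = +-cancelʳ-≤ 2 _ _ (begin
    x q + 2                          ≤⟨ +-monoʳ-≤ (x q) two-others ⟩
    x q + sum (λ k → x (punchIn q k)) ≡⟨ sum-remove {i = q} x ⟨
    sum x                            ≡⟨ sum-nbrs-V v ⟩
    nbrs full v                      ≡⟨ degree≡nbrs-full v ⟨
    degree G v                       ≤⟨ deg≤3 v ⟩
    3                                ∎)
    where
    open ≤-Reasoning
    q : Fin 4
    q = label v
    x : Fin 4 → ℕ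
    x c = nbrs (V c) v
    seen : ∀ k l → k ≢ l → 1 ≤ x (punchIn q k) + x (punchIn q l)
    seen k l k≢l = subst (1 ≤_) (nbrs-∪ (V-disjoint qk≢ql) v)
      (dominating-nbrs (proj₁ (cds qk≢ql)) (cong₂ _∨_ (∉V (punchInᵢ≢i q k ∘ sym)) (∉V (punchInᵢ≢i q l ∘ sym))))
      where
      qk≢ql : punchIn q k ≢ punchIn q l
      qk≢ql = k≢l ∘ punchIn-injective q k l
    two-others : 2 ≤ sum (λ k → x (punchIn q k))
    two-others = two-of-three {x (punchIn q 0F)} {x (punchIn q 1F)} {x (punchIn q 2F)}
                   (seen 0F 1F λ ()) (seen 0F 2F λ ()) (seen 1F 2F λ ())

  φ≤size : ∀ c → φ c ≤ size c
  φ≤size c = sum-mono-≤ inner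
    where
    inner : ∀ v → 𝟙 (V c v) * nbrs (V c) v ≤ 𝟙 (V c v)
    inner v with V c v in v∈c
    ... | false = z≤n
    ... | true  = subst (λ d → nbrs (V d) v + 0 ≤ 1) (∈V⇒≡ v∈c) (subst (_≤ 1) (sym (+-identityʳ _)) (own-class-nbrs≤1 v))

  -- Sum the spanning-tree bounds of G[V i ∪ V j] over j ≠ i; the arcs leaving V i are at most 3 |V i|.
  others≤φ+6 : ∀ i → sum (λ k → size (punchIn i k)) ≤ φ i + 6
  others≤φ+6 i = +-cancelˡ-≤ (6 * size i + A) _ _ (begin
    6 * size i + A + A                                         ≡⟨ spread (size i) (s 0F) (s 1F) (s 2F) ⟩
    2 * (size i + s 0F) + (2 * (size i + s 1F) + 2 * (size i + s 2F))
                                                               ≤⟨ +-mono-≤ (tree 0F) (+-mono-≤ (tree 1F) (tree 2F)) ⟩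
    φ i + φ′ 0F + 2 * e 0F + 2 + (φ i + φ′ 1F + 2 * e 1F + 2 + (φ i + φ′ 2F + 2 * e 2F + 2))
                                                               ≡⟨ collect (φ i) (φ′ 0F) (φ′ 1F) (φ′ 2F) (e 0F) (e 1F) (e 2F) ⟩
    φ i + 2 * (φ i + sum e) + (φ′ 0F + (φ′ 1F + φ′ 2F)) + 6    ≤⟨ +-monoˡ-≤ 6 (+-mono-≤ (+-monoʳ-≤ (φ i) (*-monoʳ-≤ 2 out))
                                                                    (+-mono-≤ (φ≤size _) (+-mono-≤ (φ≤size _) (φ≤size _)))) ⟩
    φ i + 2 * (3 * size i) + (s 0F + (s 1F + s 2F)) + 6        ≡⟨ finish (φ i) (size i) (s 0F) (s 1F) (s 2F) ⟩
    6 * size i + A + (φ i + 6)                                 ∎)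
    where
    open ≤-Reasoning
    j : Fin 3 → Fin 4
    j = punchIn i
    s φ′ e : Fin 3 → ℕ
    s k = size (j k)
    φ′ k = φ (j k)
    e k = arcs (V i) (V (j k))
    A : ℕ
    A = sum s
    i≢j : ∀ k → i ≢ j k
    i≢j k = punchInᵢ≢i i k ∘ sym
    tree : ∀ k → 2 * (size i + s k) ≤ φ i + φ′ k + 2 * e k + 2
    tree k with inhabited label-onto i
    ... | u , u∈i = subst₂ (λ c a → 2 * c ≤ a + 2) (size-∪ (i≢j k)) (arcs-∪ (V-disjoint (i≢j k)))
      (arcs-connected (V i ∪ V (j k)) (proj₂ (cds (i≢j k))) u (cong (_∨ V (j k) u) u∈i))
    out : φ i + sum e ≤ 3 * size i
    out = begin
      φ i + sum e                      ≡⟨ sum-remove {i = i} (λ c → arcs (V i) (V c)) ⟨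
      sum (λ c → arcs (V i) (V c))     ≡⟨ sum-arcs-V (V i) ⟩
      arcs (V i) full                  ≤⟨ arcs-full≤ deg≤3 (V i) ⟩
      3 * size i                       ∎
    spread : ∀ a b c d → 6 * a + (b + (c + (d + 0))) + (b + (c + (d + 0))) ≡ 2 * (a + b) + (2 * (a + c) + 2 * (a + d))
    spread = solve-∀
    collect : ∀ f f₀ f₁ f₂ e₀ e₁ e₂ → f + f₀ + 2 * e₀ + 2 + (f + f₁ + 2 * e₁ + 2 + (f + f₂ + 2 * e₂ + 2))
                                      ≡ f + 2 * (f + (e₀ + (e₁ + (e₂ + 0)))) + (f₀ + (f₁ + f₂)) + 6
    collect = solve-∀
    finish : ∀ f a b c d → f + 2 * (3 * a) + (b + (c + d)) + 6 ≡ 6 * a + (b + (c + (d + 0))) + (f + 6)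
    finish = solve-∀

  order≤10 : n ≤ 10
  order≤10 = subst (_≤ 10) (sym order≡∑size)
    (K4-arithmetic (φ≤size 0F) (φ≤size 1F) (φ≤size 2F) (φ≤size 3F)
      (others≤φ+6 0F) (others≤φ+6 1F) (others≤φ+6 2F) (others≤φ+6 3F) (arcs-even (V 0F)))

-- K₂,₃

-- In the K₂,₃ lemmas a, a′ and y count the neighbours of a vertex of one A-class in its own
-- class, in the other A-class and in the three B-classes.
seen⇒a+y≤2 : ∀ {a a′ y} → a + a′ + y ≤ 3 → 1 ≤ a′ → a + y ≤ 2
seen⇒a+y≤2 {a} {a′} {y} deg 1≤a′ = +-cancelʳ-≤ 1 (a + y) 2 (begin
  a + y + 1   ≡⟨ regroup a y ⟩
  a + 1 + y   ≤⟨ +-monoˡ-≤ y (+-monoʳ-≤ a 1≤a′) ⟩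
  a + a′ + y  ≤⟨ deg ⟩
  3           ∎)
  where
  open ≤-Reasoning
  regroup : ∀ a y → a + y + 1 ≡ a + 1 + y
  regroup = solve-∀

unseen⇒a≡0 : ∀ {a a′ y} → a + a′ + y ≤ 3 → 3 ≤ y → a ≡ 0
unseen⇒a≡0 {a} {a′} {y} deg 3≤y =
  n≤0⇒n≡0 (+-cancelʳ-≤ 3 a 0 (≤-trans (+-monoʳ-≤ a 3≤y) (≤-trans (+-monoˡ-≤ y (m≤m+n a a′)) deg)))

K23-vertex-bound : ∀ {a a′ y} → a + a′ + y ≤ 3 → 1 ≤ a′ ⊎ 3 ≤ y → 3 * a + 2 * y ≤ 6
K23-vertex-bound {a} {a′} {y} deg (inj₁ 1≤a′) = begin
  3 * a + 2 * y  ≤⟨ +-monoʳ-≤ (3 * a) (*-monoˡ-≤ y {2} {3} (s≤s (s≤s z≤n))) ⟩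
  3 * a + 3 * y  ≡⟨ *-distribˡ-+ 3 a y ⟨
  3 * (a + y)    ≤⟨ *-monoʳ-≤ 3 (seen⇒a+y≤2 {a} {a′} {y} deg 1≤a′) ⟩
  6              ∎
  where open ≤-Reasoning
K23-vertex-bound {a} {a′} {y} deg (inj₂ 3≤y) =
  subst (λ a → 3 * a + 2 * y ≤ 6) (sym (unseen⇒a≡0 {a} {a′} {y} deg 3≤y)) (*-monoʳ-≤ 2 (≤-trans (m≤n+m y (a + a′)) deg))

K23-tight-seen : ∀ {a a′ y} → a + a′ + y ≤ 3 → 1 ≤ a′ → 3 * a + 2 * y ≡ 6 → y ≡ 0
K23-tight-seen {a} {a′} {y} deg 1≤a′ tight = n≤0⇒n≡0 (+-cancelˡ-≤ 6 y 0 (begin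
  6 + y               ≡⟨ cong (_+ y) tight ⟨
  3 * a + 2 * y + y   ≡⟨ regroup a y ⟩
  3 * (a + y)         ≤⟨ *-monoʳ-≤ 3 (seen⇒a+y≤2 {a} {a′} {y} deg 1≤a′) ⟩
  6 + 0               ∎))
  where
  open ≤-Reasoning
  regroup : ∀ a y → 3 * a + 2 * y + y ≡ 3 * (a + y)
  regroup = solve-∀

module K23-Bound {n} {G : Graph n} (deg≤3 : ∀ v → degree G v ≤ 3) (L : CoalitionLabelling G (adjOf K23)) where
  open CoalitionLabelling L
  open GraphCounting G
  open Classes G label

  x : Fin 5 → Fin n → ℕ
  x c v = nbrs (V c) v

  φ : Fin 5 → ℕ
  φ c = arcs (V c) (V c)

  pair-cds : ∀ {i j} → adjOf K23 i j ≡ true → IsCDS G (V i ∪ V j)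
  pair-cds = coalition-cds _ _

  degree-split : ∀ v → x 0F v + (x 1F v + (x 2F v + (x 3F v + (x 4F v + 0)))) ≤ 3
  degree-split v = subst (_≤ 3) (trans (degree≡nbrs-full v) (sym (sum-nbrs-V v))) (deg≤3 v)

  -- α and α′ are the classes of one side of K₂,₃ and β enumerates the other side.
  module A-class (α α′ : Fin 5) (β : Fin 3 → Fin 5) (α≢α′ : α ≢ α′) (α≢β : ∀ k → α ≢ β k) (α′≢β : ∀ k → α′ ≢ β k)
                 (edge : ∀ k → adjOf K23 α (β k) ≡ true) (edge′ : ∀ k → adjOf K23 α′ (β k) ≡ true)
                 (split : ∀ v → x α v + x α′ v + sum (λ k → x (β k) v) ≤ 3) where

    y : Fin n → ℕ
    y v = sum (λ k → x (β k) v)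

    dominated : ∀ {v} k → v ∈ V α → 1 ≤ x α′ v + x (β k) v
    dominated {v} k v∈α = subst (1 ≤_) (nbrs-∪ (V-disjoint (α′≢β k)) v)
      (dominating-nbrs (proj₁ (pair-cds (edge′ k))) (cong₂ _∨_ (∈V⇒∉V v∈α α≢α′) (∈V⇒∉V v∈α (α≢β k))))

    seen-or-unseen : ∀ {v} → v ∈ V α → 1 ≤ x α′ v ⊎ 3 ≤ y v
    seen-or-unseen {v} v∈α with x α′ v in x′≡
    ... | suc _ = inj₁ (s≤s z≤n)
    ... | zero  = inj₂ (+-mono-≤ (unseen 0F) (+-mono-≤ (unseen 1F) (+-mono-≤ (unseen 2F) z≤n)))
      where
      unseen : ∀ k → 1 ≤ x (β k) v
      unseen k = subst (λ a → 1 ≤ a + x (β k) v) x′≡ (dominated k v∈α)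

    weight : Fin n → ℕ
    weight v = 3 * x α v + 2 * y v

    weight≤6 : ∀ v → 𝟙 (V α v) * weight v ≤ 𝟙 (V α v) * 6
    weight≤6 v with V α v in v∈α
    ... | false = z≤n
    ... | true  = +-monoˡ-≤ 0 (K23-vertex-bound {x α v} {x α′ v} {y v} (split v) (seen-or-unseen v∈α))

    -- Growing G[V α ∪ V β] from V β, each vertex of V α costs one new edge.
    arcs-to-β : ∀ k → 2 * size α ≤ φ α + 2 * arcs (V α) (V (β k))
    arcs-to-β k with inhabited label-onto (β k)
    ... | u , u∈β = +-cancelˡ-≤ (φ (β k) + 2 * size (β k)) _ _ (begin
      φ (β k) + 2 * size (β k) + 2 * size α                     ≡⟨ regroup₁ (φ (β k)) (size (β k)) (size α) ⟩
      φ (β k) + 2 * (size α + size (β k))                       ≡⟨ cong (λ c → φ (β k) + 2 * c) (size-∪ (α≢β k)) ⟨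
      φ (β k) + 2 * card S                                      ≤⟨ arcs-growth S (proj₂ (pair-cds (edge k))) (V (β k)) u β⊆S u∈β ⟩
      arcs S S + 2 * size (β k)                                 ≡⟨ cong (_+ 2 * size (β k)) (arcs-∪ (V-disjoint (α≢β k))) ⟩
      φ α + φ (β k) + 2 * arcs (V α) (V (β k)) + 2 * size (β k) ≡⟨ regroup₂ (φ α) (φ (β k)) (arcs (V α) (V (β k))) (size (β k)) ⟩
      φ (β k) + 2 * size (β k) + (φ α + 2 * arcs (V α) (V (β k))) ∎)
      where
      open ≤-Reasoning
      S : VSet n
      S = V α ∪ V (β k)
      β⊆S : V (β k) ⊆ S
      β⊆S v v∈β = trans (cong (V α v ∨_) v∈β) (∨-zeroʳ (V α v))
      regroup₁ : ∀ f b a → f + 2 * b + 2 * a ≡ f + 2 * (a + b)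
      regroup₁ = solve-∀
      regroup₂ : ∀ f g e b → f + g + 2 * e + 2 * b ≡ g + 2 * b + (f + 2 * e)
      regroup₂ = solve-∀

    weight-sum : sum (λ v → 𝟙 (V α v) * weight v) ≡ 3 * φ α + 2 * sum (λ k → arcs (V α) (V (β k)))
    weight-sum = begin
      sum (λ v → 𝟙 (V α v) * weight v)                            ≡⟨ sum-cong-≗ (λ v → distrib (𝟙 (V α v)) (x α v) (y v)) ⟩
      sum (λ v → 3 * (𝟙 (V α v) * x α v) + 2 * (𝟙 (V α v) * y v))  ≡⟨ ∑-distrib-+ (λ v → 3 * (𝟙 (V α v) * x α v)) (λ v → 2 * (𝟙 (V α v) * y v)) ⟩
      sum (λ v → 3 * (𝟙 (V α v) * x α v)) + sum (λ v → 2 * (𝟙 (V α v) * y v))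
                                                                   ≡⟨ cong₂ _+_ (*-distribˡ-sum 3 (λ v → 𝟙 (V α v) * x α v)) (*-distribˡ-sum 2 (λ v → 𝟙 (V α v) * y v)) ⟨
      3 * φ α + 2 * sum (λ v → 𝟙 (V α v) * y v)                    ≡⟨ cong (λ s → 3 * φ α + 2 * s) to-β ⟩
      3 * φ α + 2 * sum (λ k → arcs (V α) (V (β k)))               ∎
      where
      open ≡-Reasoning
      distrib : ∀ c a y → c * (3 * a + 2 * y) ≡ 3 * (c * a) + 2 * (c * y)
      distrib = solve-∀
      to-β : sum (λ v → 𝟙 (V α v) * y v) ≡ sum (λ k → arcs (V α) (V (β k)))
      to-β = trans (sum-cong-≗ (λ v → *-distribˡ-sum (𝟙 (V α v)) (λ k → x (β k) v)))
                   (∑-comm (λ v k → 𝟙 (V α v) * x (β k) v))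

    -- The three arcs-to-β bounds add up to 6 |V α| ≤ Σ_{v ∈ V α} weight v, so weight≤6 is tight.
    tight : ∀ {v} → v ∈ V α → weight v ≡ 6
    tight {v} v∈α = *-cancelˡ-≡ (weight v) 6 1 (subst (λ b → 𝟙 b * weight v ≡ 𝟙 b * 6) v∈α
      (sum-squeeze weight≤6 (begin
        sum (λ v → 𝟙 (V α v) * 6)                       ≡⟨ sum-cong-≗ (λ v → *-comm (𝟙 (V α v)) 6) ⟩
        sum (λ v → 6 * 𝟙 (V α v))                       ≡⟨ *-distribˡ-sum 6 (λ v → 𝟙 (V α v)) ⟨
        6 * size α                                      ≡⟨ regroup (size α) ⟩
        2 * size α + (2 * size α + (2 * size α + 0))    ≤⟨ +-mono-≤ (arcs-to-β 0F) (+-mono-≤ (arcs-to-β 1F) (+-monoˡ-≤ 0 (arcs-to-β 2F))) ⟩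
        φ α + 2 * e 0F + (φ α + 2 * e 1F + (φ α + 2 * e 2F + 0))
                                                        ≡⟨ collect (φ α) (e 0F) (e 1F) (e 2F) ⟩
        3 * φ α + 2 * sum e                             ≡⟨ weight-sum ⟨
        sum (λ v → 𝟙 (V α v) * weight v)                ∎) v))
      where
      open ≤-Reasoning
      e : Fin 3 → ℕ
      e k = arcs (V α) (V (β k))
      regroup : ∀ s → 6 * s ≡ 2 * s + (2 * s + (2 * s + 0))
      regroup = solve-∀
      collect : ∀ f a b c → f + 2 * a + (f + 2 * b + (f + 2 * c + 0)) ≡ 3 * f + 2 * (a + (b + (c + 0)))
      collect = solve-∀

    Seen : Fin n → Set
    Seen v = v ∈ V α × 1 ≤ x α′ v

    Seen? : Decidable Seen
    Seen? v = (V α v ≟ᵇ true) ×-dec (1 ≤? x α′ v)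

    seen⇒no-β₀ : ∀ {v} → Seen v → x (β 0F) v ≡ 0
    seen⇒no-β₀ {v} (v∈α , seen) =
      n≤0⇒n≡0 (≤-trans (m≤m+n _ _) (≤-reflexive (K23-tight-seen {x α v} {x α′ v} {y v} (split v) seen (tight v∈α))))

    unseen⇒no-inner : ∀ {v} → v ∈ V α → ¬ 1 ≤ x α′ v → x α v ≡ 0
    unseen⇒no-inner {v} v∈α unseen with seen-or-unseen v∈α
    ... | inj₁ seen = ⊥-elim (unseen seen)
    ... | inj₂ 3≤y  = unseen⇒a≡0 {x α v} {x α′ v} {y v} (split v) 3≤y

    no-exit : ∀ {v w} → Seen v → ¬ Seen w → w ∈ (V α ∪ V (β 0F)) → adj G v w ≡ true → ⊥
    no-exit {v} {w} (v∈α , v-seen) w-unseen w∈S vw with V α w ≟ᵇ true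
    ... | yes w∈α = m<n⇒n≢0 (nbrs-pos {V α} v∈α (trans (Graph.sym G w v) vw))
                             (unseen⇒no-inner w∈α (λ seen → w-unseen (w∈α , seen)))
    ... | no  w∉α = m<n⇒n≢0 (nbrs-pos {V (β 0F)} w∈β₀ vw) (seen⇒no-β₀ (v∈α , v-seen))
      where
      w∈β₀ : w ∈ V (β 0F)
      w∈β₀ with V α w
      ... | true  = ⊥-elim (w∉α refl)
      ... | false = w∈S

    -- A path inside V α ∪ V (β 0F) from a seen vertex to V (β 0F) would have to step from a
    -- seen to an unseen vertex.
    no-cross : ∀ {u} → u ∈ V α → x α′ u ≡ 0
    no-cross {u} u∈α with 1 ≤? x α′ u | inhabited label-onto (β 0F)
    ... | no  unseen | _       = n<1⇒n≡0 (≰⇒> unseen)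
    ... | yes seen   | b , b∈β with reach-exit Seen? (proj₂ (pair-cds (edge 0F)) u b (cong (_∨ V (β 0F) u) u∈α)
                                            (trans (cong (V α b ∨_) b∈β) (∨-zeroʳ (V α b))))
                                          (u∈α , seen) (λ (b∈α , _) → V-disjoint (α≢β 0F) b b∈α b∈β)
    ...   | v , w , v-seen , w-unseen , w∈S , vw = ⊥-elim (no-exit v-seen w-unseen w∈S vw)

    no-inner : ∀ {v} → v ∈ V α → x α v ≡ 0
    no-inner v∈α = unseen⇒no-inner v∈α (λ seen → m<n⇒n≢0 seen (no-cross v∈α))

    one-β₀ : ∀ {v} → v ∈ V α → x (β 0F) v ≡ 1
    one-β₀ {v} v∈α = ≤-antisym (+-cancelʳ-≤ 2 _ 1 (begin
      x (β 0F) v + 2                               ≤⟨ +-monoʳ-≤ (x (β 0F) v) (+-mono-≤ (unseen 1F) (+-monoˡ-≤ 0 (unseen 2F))) ⟩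
      x (β 0F) v + (x (β 1F) v + (x (β 2F) v + 0)) ≤⟨ m≤n+m (y v) (x α v + x α′ v) ⟩
      x α v + x α′ v + y v                         ≤⟨ split v ⟩
      3                                            ∎)) (unseen 0F)
      where
      open ≤-Reasoning
      unseen : ∀ k → 1 ≤ x (β k) v
      unseen k = subst (λ a → 1 ≤ a + x (β k) v) (no-cross v∈α) (dominated k v∈α)

  B : Fin 3 → Fin 5
  B 0F = 2F
  B 1F = 3F
  B 2F = 4F

  0≢B : ∀ k → 0F ≢ B k
  0≢B 0F ()
  0≢B 1F ()
  0≢B 2F ()

  1≢B : ∀ k → 1F ≢ B k
  1≢B 0F ()
  1≢B 1F ()
  1≢B 2F ()

  edge₀ : ∀ k → adjOf K23 0F (B k) ≡ true
  edge₀ 0F = refl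
  edge₀ 1F = refl
  edge₀ 2F = refl

  edge₁ : ∀ k → adjOf K23 1F (B k) ≡ true
  edge₁ 0F = refl
  edge₁ 1F = refl
  edge₁ 2F = refl

  split₀ : ∀ v → x 0F v + x 1F v + sum (λ k → x (B k) v) ≤ 3
  split₀ v = subst (_≤ 3) (regroup (x 0F v) (x 1F v) (x 2F v) (x 3F v) (x 4F v)) (degree-split v)
    where
    regroup : ∀ a b c d e → a + (b + (c + (d + (e + 0)))) ≡ a + b + (c + (d + (e + 0)))
    regroup = solve-∀

  split₁ : ∀ v → x 1F v + x 0F v + sum (λ k → x (B k) v) ≤ 3
  split₁ v = subst (_≤ 3) (regroup (x 0F v) (x 1F v) (x 2F v) (x 3F v) (x 4F v)) (degree-split v)
    where
    regroup : ∀ a b c d e → a + (b + (c + (d + (e + 0)))) ≡ b + a + (c + (d + (e + 0)))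
    regroup = solve-∀

  module A₀ = A-class 0F 1F B (λ ()) 0≢B 1≢B edge₀ edge₁ split₀
  module A₁ = A-class 1F 0F B (λ ()) 1≢B 0≢B edge₁ edge₀ split₁

  sum-over-V : ∀ c (f : Fin n → ℕ) m → (∀ {v} → v ∈ V c → f v ≡ m) → sum (λ v → 𝟙 (V c v) * f v) ≡ m * size c
  sum-over-V c f m const = trans (sum-cong-≗ pointwise) (sym (*-distribˡ-sum m (λ v → 𝟙 (V c v))))
    where
    pointwise : ∀ v → 𝟙 (V c v) * f v ≡ m * 𝟙 (V c v)
    pointwise v with V c v in v∈c
    ... | true  = trans (*-identityˡ (f v)) (trans (const v∈c) (sym (*-identityʳ m)))
    ... | false = sym (*-zeroʳ m)

  φ₀≡0 : φ 0F ≡ 0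
  φ₀≡0 = sum-over-V 0F (x 0F) 0 A₀.no-inner

  arcs-to-V₂ : ∀ {α} → (∀ {v} → v ∈ V α → x 2F v ≡ 1) → arcs (V α) (V 2F) ≡ size α
  arcs-to-V₂ {α} one = trans (sum-over-V α (x 2F) 1 one) (*-identityˡ (size α))

  -- Every vertex of V 0 ∪ V 1 is a leaf hanging from V 2, and V 0 ∪ V 2 is connected.
  A-sides≤ : size 0F + size 1F ≤ size 2F + 2
  A-sides≤ = +-cancelʳ-≤ (2 * size 2F) _ _ (begin
    size 0F + size 1F + 2 * size 2F                  ≤⟨ +-monoʳ-≤ (size 0F + size 1F) V₂-tree ⟩
    size 0F + size 1F + (φ 2F + 2)                   ≡⟨ regroup (size 0F) (size 1F) (φ 2F) ⟩
    size 0F + size 1F + φ 2F + 2                     ≤⟨ +-monoˡ-≤ 2 V₂-degrees ⟩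
    3 * size 2F + 2                                  ≡⟨ regroup′ (size 2F) ⟩
    size 2F + 2 + 2 * size 2F                        ∎)
    where
    open ≤-Reasoning
    regroup : ∀ a b f → a + b + (f + 2) ≡ a + b + f + 2
    regroup = solve-∀
    regroup′ : ∀ s → 3 * s + 2 ≡ s + 2 + 2 * s
    regroup′ = solve-∀
    V₂-tree : 2 * size 2F ≤ φ 2F + 2
    V₂-tree with inhabited label-onto 0F
    ... | u , u∈0 = +-cancelˡ-≤ (2 * size 0F) _ _ (begin
      2 * size 0F + 2 * size 2F                        ≡⟨ *-distribˡ-+ 2 (size 0F) (size 2F) ⟨
      2 * (size 0F + size 2F)                          ≡⟨ cong (2 *_) (size-∪ (λ ())) ⟨
      2 * card (V 0F ∪ V 2F)                           ≤⟨ arcs-connected (V 0F ∪ V 2F) (proj₂ (pair-cds refl)) u (cong (_∨ V 2F u) u∈0) ⟩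
      arcs (V 0F ∪ V 2F) (V 0F ∪ V 2F) + 2             ≡⟨ cong (_+ 2) (arcs-∪ (V-disjoint (λ ()))) ⟩
      φ 0F + φ 2F + 2 * arcs (V 0F) (V 2F) + 2         ≡⟨ cong₂ (λ a e → a + φ 2F + 2 * e + 2) φ₀≡0 (arcs-to-V₂ A₀.one-β₀) ⟩
      0 + φ 2F + 2 * size 0F + 2                       ≡⟨ regroup″ (φ 2F) (size 0F) ⟩
      2 * size 0F + (φ 2F + 2)                         ∎)
      where
      regroup″ : ∀ f a → 0 + f + 2 * a + 2 ≡ 2 * a + (f + 2)
      regroup″ = solve-∀
    V₂-degrees : size 0F + size 1F + φ 2F ≤ 3 * size 2F
    V₂-degrees = begin
      size 0F + size 1F + φ 2F                         ≡⟨ cong₂ (λ a b → a + b + φ 2F) (trans (arcs-comm (V 2F) (V 0F)) (arcs-to-V₂ A₀.one-β₀))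
                                                                                         (trans (arcs-comm (V 2F) (V 1F)) (arcs-to-V₂ A₁.one-β₀)) ⟨
      e 0F + e 1F + e 2F                               ≤⟨ partial (e 0F) (e 1F) (e 2F) (e 3F) (e 4F) ⟩
      sum e                                            ≡⟨ sum-arcs-V (V 2F) ⟩
      arcs (V 2F) full                                 ≤⟨ arcs-full≤ deg≤3 (V 2F) ⟩
      3 * size 2F                                      ∎
      where
      e : Fin 5 → ℕ
      e c = arcs (V 2F) (V c)
      partial : ∀ a b c d f → a + b + c ≤ a + (b + (c + (d + (f + 0))))
      partial a b c d f = subst (_≤ a + (b + (c + (d + (f + 0))))) (sym (+-assoc a b c))
        (+-monoʳ-≤ a (+-monoʳ-≤ b (m≤m+n c (d + (f + 0)))))

  B-class≤2 : ∀ b b₀ b₁ → 0F ≢ b₀ → 1F ≢ b₁ → adjOf K23 0F b₀ ≡ true → adjOf K23 1F b₁ ≡ true →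
              size 0F + size b₀ + (size 1F + size b₁ + 0) + size b ≡ n → size b ≤ 2
  B-class≤2 b b₀ b₁ 0≢b₀ 1≢b₁ edge-0b₀ edge-1b₁ covers = *-cancelˡ-≤ 2 (+-cancelˡ-≤ (2 * S) _ _ (begin
    2 * S + 2 * size b   ≡⟨ *-distribˡ-+ 2 S (size b) ⟨
    2 * (S + size b)     ≡⟨ cong (2 *_) covers ⟩
    2 * n                ≤⟨ coalition-family-order deg≤3 L e₁ e₂ e₁≢e₂ edge ⟩
    2 * S + 4            ∎))
    where
    open ≤-Reasoning
    S : ℕ
    S = size 0F + size b₀ + (size 1F + size b₁ + 0)
    e₁ e₂ : Fin 2 → Fin 5
    e₁ 0F = 0F
    e₁ 1F = 1F
    e₂ 0F = b₀
    e₂ 1F = b₁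
    e₁≢e₂ : ∀ k → e₁ k ≢ e₂ k
    e₁≢e₂ 0F = 0≢b₀
    e₁≢e₂ 1F = 1≢b₁
    edge : ∀ k → adjOf K23 (e₁ k) (e₂ k) ≡ true
    edge 0F = edge-0b₀
    edge 1F = edge-1b₁

  order≤10 : n ≤ 10
  order≤10 = begin
    n                                                  ≡⟨ order≡∑size ⟩
    size 0F + (size 1F + (size 2F + (size 3F + (size 4F + 0)))) ≡⟨ regroup (size 0F) (size 1F) (size 2F) (size 3F) (size 4F) ⟩
    size 0F + size 1F + (size 2F + (size 3F + size 4F)) ≤⟨ +-mono-≤ A-sides≤ (+-mono-≤ s₂≤2 (+-mono-≤ s₃≤2 s₄≤2)) ⟩
    size 2F + 2 + (2 + (2 + 2))                        ≤⟨ +-monoˡ-≤ 6 (+-monoˡ-≤ 2 s₂≤2) ⟩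
    10                                                 ∎
    where
    open ≤-Reasoning
    regroup : ∀ a b c d e → a + (b + (c + (d + (e + 0)))) ≡ a + b + (c + (d + e))
    regroup = solve-∀
    cover₂ : ∀ a b c d e → a + d + (b + e + 0) + c ≡ a + (b + (c + (d + (e + 0))))
    cover₂ = solve-∀
    cover₃ : ∀ a b c d e → a + c + (b + e + 0) + d ≡ a + (b + (c + (d + (e + 0))))
    cover₃ = solve-∀
    cover₄ : ∀ a b c d e → a + c + (b + d + 0) + e ≡ a + (b + (c + (d + (e + 0))))
    cover₄ = solve-∀
    s₂≤2 : size 2F ≤ 2
    s₂≤2 = B-class≤2 2F 3F 4F (λ ()) (λ ()) refl refl
             (trans (cover₂ (size 0F) (size 1F) (size 2F) (size 3F) (size 4F)) (sym order≡∑size))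
    s₃≤2 : size 3F ≤ 2
    s₃≤2 = B-class≤2 3F 2F 4F (λ ()) (λ ()) refl refl
             (trans (cover₃ (size 0F) (size 1F) (size 2F) (size 3F) (size 4F)) (sym order≡∑size))
    s₄≤2 : size 4F ≤ 2
    s₄≤2 = B-class≤2 4F 2F 3F (λ ()) (λ ()) refl refl
             (trans (cover₄ (size 0F) (size 1F) (size 2F) (size 3F) (size 4F)) (sym order≡∑size))

-- Realisations

first : ∀ {k} {A : Set} → (Fin k → Maybe A) → Maybe A
first = foldr _<∣>_ nothing

every : ∀ {k} {P : Fin k → Set} → ((i : Fin k) → Maybe (P i)) → Maybe ((i : Fin k) → P i)
every {zero}  f = just λ ()
every {suc k} f = zipWith (λ p ps → λ { zero → p ; (suc i) → ps i }) (f zero) (every (f ∘ suc))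

-- Certificate search: `just` carries a proof, `nothing` only means that the search failed.
module Certificates {n} (G : Graph n) where

  dominating? : (S : VSet n) → Dec (Dominating G S)
  dominating? S = all? λ v → ¬? (S v ≟ᵇ true) →-dec any? λ u → (S u ≟ᵇ true) ×-dec (adj G v u ≟ᵇ true)

  disjoint? : (A B : VSet n) → Dec (Disjoint A B)
  disjoint? A B = all? λ v → (A v ≟ᵇ true) →-dec (B v ≟ᵇ true) →-dec no id

  singleton? : (S : VSet n) → Dec (Singleton S)
  singleton? S = any? λ v → (S v ≟ᵇ true) ×-dec all? λ w → (S w ≟ᵇ true) →-dec w ≟ v

  walk : ℕ → (S : VSet n) (u v : Fin n) → Maybe (Reach G S u v)
  walk d S u v with u ≟ v
  walk d       S u v | yes refl = just here
  walk zero    S u v | no _     = nothing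
  walk (suc d) S u v | no _     = first λ w → extend w (adj G u w ≟ᵇ true) (S w ≟ᵇ true)
    where
    extend : ∀ w → Dec (adj G u w ≡ true) → Dec (w ∈ S) → Maybe (Reach G S u v)
    extend w (yes uw) (yes w∈S) = map (step uw w∈S) (walk d S w v)
    extend w _        _         = nothing

  connected? : (S : VSet n) → Maybe (InducedConnected G S)
  connected? S = every λ u → every λ v → joined (S u ≟ᵇ true) (S v ≟ᵇ true)
    where
    joined : ∀ {u v} → Dec (u ∈ S) → Dec (v ∈ S) → Maybe (u ∈ S → v ∈ S → Reach G S u v)
    joined {u} {v} (yes _) (yes _) = map (λ r _ _ → r) (first λ (d : Fin (suc n)) → walk (toℕ d) S u v)
    joined (no u∉S) _        = just λ u∈S → ⊥-elim (u∉S u∈S)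
    joined _        (no v∉S) = just λ _ v∈S → ⊥-elim (v∉S v∈S)

  Closed : VSet n → VSet n → Set
  Closed S C = ∀ a b → C a ≡ true → adj G a b ≡ true → S b ≡ true → C b ≡ true

  closed? : ∀ S C → Dec (Closed S C)
  closed? S C = all? λ a → all? λ b → (C a ≟ᵇ true) →-dec (adj G a b ≟ᵇ true) →-dec (S b ≟ᵇ true) →-dec (C b ≟ᵇ true)

  reach-closed : ∀ {S C} → Closed S C → ∀ {u v} → Reach G S u v → C u ≡ true → C v ≡ true
  reach-closed closed here             Cu = Cu
  reach-closed closed (step uw w∈S w⇝v) Cu = reach-closed closed w⇝v (closed _ _ Cu uw w∈S)

  component : (S : VSet n) → Fin n → VSet n
  component S u = grow n λ w → S w ∧ does (w ≟ u)
    where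
    grow : ℕ → VSet n → VSet n
    grow zero    C = C
    grow (suc k) C = grow k λ b → C b ∨ (S b ∧ does (any? λ a → (C a ∧ adj G a b) ≟ᵇ true))

  disconnected? : (S : VSet n) → Maybe (¬ InducedConnected G S)
  disconnected? S = first λ u → first λ v →
    separated (S u ≟ᵇ true) (S v ≟ᵇ true) (component S u u ≟ᵇ true) (component S u v ≟ᵇ false) (closed? S (component S u))
    where
    separated : ∀ {u v} → Dec (u ∈ S) → Dec (v ∈ S) → Dec (component S u u ≡ true) → Dec (component S u v ≡ false) →
                Dec (Closed S (component S u)) → Maybe (¬ InducedConnected G S)
    separated {u} {v} (yes u∈S) (yes v∈S) (yes u∈C) (yes v∉C) (yes closed) =
      just λ conn → case trans (sym (reach-closed closed (conn u v u∈S v∈S) u∈C)) v∉C of λ ()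
    separated _ _ _ _ _ = nothing

  cds? : (S : VSet n) → Maybe (IsCDS G S)
  cds? S = zipWith _,_ (dec⇒maybe (dominating? S)) (connected? S)

  not-cds? : (S : VSet n) → Maybe (¬ IsCDS G S)
  not-cds? S = map (λ ¬dom → ¬dom ∘ proj₁) (dec⇒maybe (¬? (dominating? S)))
           <∣> map (λ ¬conn → ¬conn ∘ proj₂) (disconnected? S)

  coalition? : (A B : VSet n) → Maybe (ConnCoalition G A B)
  coalition? A B = zipWith _,_ (dec⇒maybe (disjoint? A B))
                     (zipWith _,_ (not-cds? A) (zipWith _,_ (not-cds? B) (cds? (A ∪ B))))

  not-coalition? : (A B : VSet n) → Maybe (¬ ConnCoalition G A B)
  not-coalition? A B = map (λ ¬disj c → ¬disj (proj₁ c)) (dec⇒maybe (¬? (disjoint? A B)))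
                   <∣> map (λ cdsA c → proj₁ (proj₂ c) cdsA) (cds? A)
                   <∣> map (λ cdsB c → proj₁ (proj₂ (proj₂ c)) cdsB) (cds? B)
                   <∣> map (λ ¬cds c → ¬cds (coalition⇒cds-∪ c)) (not-cds? (A ∪ B))

  subcubic? : Maybe (Subcubic G)
  subcubic? = zipWith _,_ (connected? full) (dec⇒maybe (all? λ v → degree G v ≤? 3))

  module _ {m} (π : Partition n m) (H : Fin m → Fin m → Bool) where

    ccp? : Maybe (IsCCP G π)
    ccp? = every λ i → map inj₁ (zipWith _,_ (cds? (cls π i)) (dec⇒maybe (singleton? (cls π i))))
                   <∣> map inj₂ (first λ j → partner (j ≟ i) (coalition? (cls π i) (cls π j)))
      where
      partner : ∀ {i j} → Dec (j ≡ i) → Maybe (ConnCoalition G (cls π i) (cls π j)) →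
                Maybe (∃ λ j → j ≢ i × ConnCoalition G (cls π i) (cls π j))
      partner {j = j} (no j≢i) c = map (λ c → j , j≢i , c) c
      partner         (yes _)  _ = nothing

    iso? : Maybe (CCGIso G π H)
    iso? = map (↔-id (Fin m) ,_) (every λ i → every λ j → agrees i j)
      where
      agrees : ∀ i j → Maybe ((CCGAdj G π i j → H i j ≡ true) × (H i j ≡ true → CCGAdj G π i j))
      agrees i j with H i j
      ... | true  = map (λ c → (λ _ → refl) , (λ _ → c)) (coalition? (cls π i) (cls π j))
      ... | false = map (λ ¬c → (λ c → ⊥-elim (¬c c)) , λ ()) (not-coalition? (cls π i) (cls π j))

    witness? : Maybe (Subcubic G × IsCCP G π × CCGIso G π H)
    witness? = zipWith _,_ subcubic? (zipWith _,_ ccp? iso?)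

  partition? : ∀ {m} → (Fin n → Fin m) → Maybe (Partition n m)
  partition? label = map (λ onto → record { part = label ; nonempty = onto }) (every λ c → first λ v → found (label v ≟ c))
    where
    found : ∀ {v c} → Dec (label v ≡ c) → Maybe (∃ λ w → label w ≡ c)
    found {v} (yes lv≡c) = just (v , lv≡c)
    found     (no _)     = nothing

joins : List (ℕ × ℕ) → ℕ → ℕ → Bool
joins es a b = any (λ (c , d) → (a ≡ᵇ c) ∧ (b ≡ᵇ d)) es

adjacency : ∀ {n} → List (ℕ × ℕ) → Fin n → Fin n → Bool
adjacency es i j = joins es (toℕ i) (toℕ j) ∨ joins es (toℕ j) (toℕ i)

loopless? : ∀ n (es : List (ℕ × ℕ)) → Dec (∀ i → adjacency {n} es i i ≡ false)
loopless? n es = all? λ i → adjacency es i i ≟ᵇ false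

graph : ∀ n (es : List (ℕ × ℕ)) → (∀ i → adjacency {n} es i i ≡ false) → Graph n
graph n es loopless = record
  { adj    = adjacency es
  ; sym    = λ i j → ∨-comm (joins es (toℕ i) (toℕ j)) (joins es (toℕ j) (toℕ i))
  ; irrefl = loopless
  }

Realisation : ∀ {m} → (Fin m → Fin m → Bool) → Set
Realisation H = Σ ℕ λ n → Σ (Graph n) λ G → Σ ℕ λ k → Σ (Partition n k) λ π → Subcubic G × IsCCP G π × CCGIso G π H

realisation? : ∀ n m → List (ℕ × ℕ) → (Fin n → Fin m) → (H : Fin m → Fin m → Bool) → Maybe (Realisation H)
realisation? n m es label H =
  dec⇒maybe (loopless? n es) >>= λ loopless → let G = graph n es loopless in
  Certificates.partition? G label >>= λ π →
  map (λ witness → n , G , m , π , witness) (Certificates.witness? G π H)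

example : (t : Target) → Realisation (adjOf t)
example K1      = from-just (realisation? 1 1 [] (lookup (0F ∷ [])) (adjOf K1))
example coK2    = from-just (realisation? 2 2 ((0 , 1) ∷ []) (lookup (0F ∷ 1F ∷ [])) (adjOf coK2))
example coK3    = from-just (realisation? 3 3 ((0 , 1) ∷ (0 , 2) ∷ (1 , 2) ∷ [])
                               (lookup (0F ∷ 1F ∷ 2F ∷ [])) (adjOf coK3))
example K4      = from-just (realisation? 8 4 ((0 , 2) ∷ (0 , 5) ∷ (0 , 7) ∷ (1 , 3) ∷ (1 , 4) ∷ (1 , 6) ∷ (2 , 3) ∷ (2 , 4) ∷
                                              (3 , 6) ∷ (4 , 7) ∷ (5 , 6) ∷ (5 , 7) ∷ [])
                               (lookup (0F ∷ 0F ∷ 1F ∷ 1F ∷ 2F ∷ 3F ∷ 3F ∷ 2F ∷ [])) (adjOf K4))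
example coK4    = from-just (realisation? 4 4 ((0 , 1) ∷ (0 , 2) ∷ (0 , 3) ∷ (1 , 2) ∷ (1 , 3) ∷ (2 , 3) ∷ [])
                               (lookup (0F ∷ 1F ∷ 2F ∷ 3F ∷ [])) (adjOf coK4))
example C5      = from-just (realisation? 8 5 ((0 , 2) ∷ (0 , 3) ∷ (0 , 6) ∷ (1 , 2) ∷ (1 , 4) ∷ (1 , 7) ∷ (2 , 5) ∷ (3 , 4) ∷
                                              (3 , 5) ∷ (4 , 6) ∷ (5 , 7) ∷ (6 , 7) ∷ [])
                               (lookup (0F ∷ 1F ∷ 1F ∷ 3F ∷ 2F ∷ 3F ∷ 4F ∷ 4F ∷ [])) (adjOf C5))
example threeK2 = from-just (realisation? 6 6 ((0 , 2) ∷ (0 , 3) ∷ (0 , 4) ∷ (1 , 2) ∷ (1 , 4) ∷ (1 , 5) ∷ (2 , 5) ∷ (3 , 4) ∷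
                                              (3 , 5) ∷ [])
                               (lookup (0F ∷ 2F ∷ 1F ∷ 4F ∷ 3F ∷ 5F ∷ [])) (adjOf threeK2))
example K23     = from-just (realisation? 5 5 ((0 , 1) ∷ (0 , 3) ∷ (0 , 4) ∷ (1 , 2) ∷ (1 , 4) ∷ (2 , 3) ∷ (2 , 4) ∷ [])
                               (lookup (0F ∷ 2F ∷ 1F ∷ 3F ∷ 4F ∷ [])) (adjOf K23))
example K33     = from-just (realisation? 6 6 ((0 , 3) ∷ (0 , 4) ∷ (0 , 5) ∷ (1 , 3) ∷ (1 , 4) ∷ (1 , 5) ∷ (2 , 3) ∷ (2 , 4) ∷
                                              (2 , 5) ∷ [])
                               (lookup (0F ∷ 1F ∷ 2F ∷ 3F ∷ 4F ∷ 5F ∷ [])) (adjOf K33))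

order≤10 : (t : Target) → ∀ (n : ℕ) (G : Graph n) (k : ℕ) (π : Partition n k) →
           Subcubic G → IsCCP G π → CCGIso G π (adjOf t) → n ≤ 10
order≤10 K1 n G k π _ ccp iso =
  ≤-trans (edgeless-order {G = G} {π = π} (adjOf K1) (λ _ _ → refl) ccp iso) (m≤m+n 1 9)
order≤10 coK2 n G k π _ ccp iso =
  ≤-trans (edgeless-order {G = G} {π = π} (adjOf coK2) (λ _ _ → refl) ccp iso) (m≤m+n 2 8)
order≤10 coK3 n G k π _ ccp iso =
  ≤-trans (edgeless-order {G = G} {π = π} (adjOf coK3) (λ _ _ → refl) ccp iso) (m≤m+n 3 7)
order≤10 coK4 n G k π _ ccp iso =
  ≤-trans (edgeless-order {G = G} {π = π} (adjOf coK4) (λ _ _ → refl) ccp iso) (m≤m+n 4 6)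
order≤10 K4 n G k π (_ , deg≤3) _ iso =
  K4-Bound.order≤10 deg≤3 (ccgIso⇒labelling {G = G} {π = π} (adjOf K4) iso)
order≤10 C5 n G k π (_ , deg≤3) _ iso =
  C5-order deg≤3 (ccgIso⇒labelling {G = G} {π = π} (adjOf C5) iso)
order≤10 threeK2 n G k π (_ , deg≤3) _ iso =
  ≤-trans (threeK2-order deg≤3 (ccgIso⇒labelling {G = G} {π = π} (adjOf threeK2) iso)) (m≤m+n 6 4)
order≤10 K23 n G k π (_ , deg≤3) _ iso =
  K23-Bound.order≤10 deg≤3 (ccgIso⇒labelling {G = G} {π = π} (adjOf K23) iso)
order≤10 K33 n G k π (_ , deg≤3) _ iso =
  ≤-trans (K33-order deg≤3 (ccgIso⇒labelling {G = G} {π = π} (adjOf K33) iso)) (m≤m+n 6 4)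

proposition1 : (t : Target) →
    (Σ ℕ λ n → Σ (Graph n) λ G → Σ ℕ λ k → Σ (Partition n k) λ π →
       Subcubic G × IsCCP G π × CCGIso G π (adjOf t))
    × (∀ (n : ℕ) (G : Graph n) (k : ℕ) (π : Partition n k) →
       Subcubic G → IsCCP G π → CCGIso G π (adjOf t) → n ≤ 10)
proposition1 t = example t , order≤10 t
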